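{- Let $P$ be a finite poset with height function $h$, let $\overline{P}$ be its dual poset, and let $H$ be an integer at least equal to the maximal value of $h$, so that $H-h$ is a height function on $\overline{P}$. Then for all $n\in\mathbb{Z}$, \[ \mathsf{Z}_{\overline{P},H-h}([n]_q)=q^{(n-1)H}\bigl(\mathsf{Z}_{P,h}([n]_q)\bigr)\big|_{q=1/q}, \] where $|_{q=1/q}$ means replacing $q$ by $1/q$ in the element $\mathsf{Z}_{P,h}([n]_q)\in\mathbb{Q}(q)$ (this substitution affects also the coefficients of the polynomial).
   Context: Let $q$ be an indeterminate and $[n]_q=(q^n-1)/(q-1)\in\mathbb{Z}[q,q^{ -1}]$ for $n\in\mathbb{Z}$. A height function on a finite poset $R$ is a map $f:R\to\mathbb{N}$ with $f(x)<f(y)$ whenever $y$ covers $x$. The $q$-Zeta polynomial $\mathsf{Z}_{R,f}(x)\in\mathbb{Q}(q)[x]$ is the unique polynomial such that for every integer $n\ge2$, $\mathsf{Z}_{R,f}([n]_q)=\sum_{e_1\le\cdots\le e_{n-1}}q^{f(e_1)+\cdots+f(e_{n-1})}$, summed over all weakly increasing sequences of $n-1$ elements of $R$; its degree is at most $\max f$. -}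

module Defs where

open import Level using (0ℓ)
open import Data.Nat as ℕ using (ℕ; zero; suc)
open import Data.Integer as ℤ using (ℤ; +_; -[1+_])
open import Data.Fin using (Fin)
open import Data.List.Relation.Unary.All using (All)
open import Data.List as List using (List; []; _∷_; foldr; map; concatMap; allFin; reverse; length)
open import Data.Vec using (Vec; []; _∷_)
open import Data.Bool using (Bool; true; false; if_then_else_; _∧_)
open import Data.Product using (_×_; ∃)
open import Relation.Nullary using (¬_)
open import Relation.Nullary.Decidable using (⌊_⌋)
open import Relation.Binary using (Rel; Decidable)
open import Relation.Binary.PropositionalEquality using (_≡_; _≢_)

-- Polynomials in q with integer coefficients: coefficient lists,
-- lowest degree first (trailing zeros allowed).

Poly : Set
Poly = List ℤ

coeff : Poly → ℕ → ℤ
coeff []       _       = + 0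
coeff (a ∷ p)  zero    = a
coeff (a ∷ p)  (suc i) = coeff p i

_≈ₚ_ : Poly → Poly → Set
p ≈ₚ r = ∀ i → coeff p i ≡ coeff r i

IsZeroPoly : Poly → Set
IsZeroPoly p = p ≈ₚ []

_+ₚ_ : Poly → Poly → Poly
[]      +ₚ r       = r
(a ∷ p) +ₚ []      = a ∷ p
(a ∷ p) +ₚ (b ∷ r) = (a ℤ.+ b) ∷ (p +ₚ r)

_·ₚ_ : ℤ → Poly → Poly
a ·ₚ p = map (a ℤ.*_) p

_*ₚ_ : Poly → Poly → Poly
[]      *ₚ r = []
(a ∷ p) *ₚ r = (a ·ₚ r) +ₚ (+ 0 ∷ (p *ₚ r))

-ₚ_ : Poly → Poly
-ₚ p = map ℤ.-_ p

mono : ℕ → Poly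
mono zero    = + 1 ∷ []
mono (suc d) = + 0 ∷ mono d

-- The field ℚ(q) = Frac(ℤ[q]): fractions num/den, with equality by
-- cross-multiplication. Well-formed elements have nonzero denominator.

record RatFun : Set where
  constructor _/_
  field
    num : Poly
    den : Poly
open RatFun public

WF : RatFun → Set
WF x = ¬ IsZeroPoly (den x)

_≈_ : RatFun → RatFun → Set
x ≈ y = (num x *ₚ den y) ≈ₚ (num y *ₚ den x)

fromPoly : Poly → RatFun
fromPoly p = p / mono 0

0r 1r : RatFun
0r = [] / mono 0
1r = mono 0 / mono 0

_+r_ : RatFun → RatFun → RatFun
(a / b) +r (c / d) = ((a *ₚ d) +ₚ (c *ₚ b)) / (b *ₚ d)

_-r_ : RatFun → RatFun → RatFun
(a / b) -r (c / d) = ((a *ₚ d) +ₚ (-ₚ (c *ₚ b))) / (b *ₚ d)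

_*r_ : RatFun → RatFun → RatFun
(a / b) *r (c / d) = (a *ₚ c) / (b *ₚ d)

_÷r_ : RatFun → RatFun → RatFun
(a / b) ÷r (c / d) = (a *ₚ d) / (b *ₚ c)

qpow : ℤ → RatFun
qpow (+ n)    = mono n / mono 0
qpow -[1+ n ] = mono 0 / mono (suc n)

qint : ℤ → RatFun
qint n = (qpow n -r 1r) ÷r fromPoly (-[1+ 0 ] ∷ + 1 ∷ [])

-- substitution q ↦ 1/q in an element of ℚ(q):
-- p(1/q) = reverse(p) / q^(length p - 1), hence
-- a(1/q)/b(1/q) = (reverse a · q^(length b)) / (reverse b · q^(length a)).
invQ : RatFun → RatFun
invQ (a / b) = (reverse a *ₚ mono (length b)) / (reverse b *ₚ mono (length a))

PolyQ : Set
PolyQ = List RatFun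

evalQ : PolyQ → RatFun → RatFun
evalQ []       x = 0r
evalQ (c ∷ cs) x = c +r (x *r evalQ cs x)

module _ {k : ℕ} (_≼_ : Rel (Fin k) 0ℓ) where

  _≺_ : Rel (Fin k) 0ℓ
  x ≺ y = (x ≼ y) × (x ≢ y)

  Covers : Fin k → Fin k → Set
  Covers x y = (x ≺ y) × ¬ (∃ λ z → (x ≺ z) × (z ≺ y))

  IsHeight : (Fin k → ℕ) → Set
  IsHeight f = ∀ x y → Covers x y → f x ℕ.< f y

allVecs : (k m : ℕ) → List (Vec (Fin k) m)
allVecs k zero    = [] ∷ []
allVecs k (suc m) = concatMap (λ i → map (i ∷_) (allVecs k m)) (allFin k)

module _ {k : ℕ} {_≼_ : Rel (Fin k) 0ℓ} (_≼?_ : Decidable _≼_) where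

  weaklyIncr : ∀ {m} → Vec (Fin k) m → Bool
  weaklyIncr []               = true
  weaklyIncr (x ∷ [])         = true
  weaklyIncr (x ∷ y ∷ rest)   = ⌊ x ≼? y ⌋ ∧ weaklyIncr (y ∷ rest)

  vsum : (Fin k → ℕ) → ∀ {m} → Vec (Fin k) m → ℕ
  vsum f []       = 0
  vsum f (x ∷ xs) = f x ℕ.+ vsum f xs

  multichainPoly : (Fin k → ℕ) → ℕ → Poly
  multichainPoly f m =
    foldr (λ v acc → if weaklyIncr v then mono (vsum f v) +ₚ acc else acc)
          [] (allVecs k m)

  IsQZeta : (Fin k → ℕ) → PolyQ → Set
  IsQZeta f Z =
    All WF Z ×
    (∀ (n : ℕ) → 2 ℕ.≤ n →
       evalQ Z (qint (+ n)) ≈ fromPoly (multichainPoly f (n ℕ.∸ 1)))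

-- For n ≥ 2, Z([n]_q) and Zbar([n]_q) are the multichain generating
-- polynomials (with m = n - 1) of P with weight h and of its dual with
-- weight H - h.  Reversing a weakly increasing sequence of the dual gives
-- one of P, and over m elements the weights H - h sum to mH minus the sum
-- of h; hence M_{P̄,H-h}(m) = q^(mH) M_{P,h}(m)|_{q=1/q}, which is the claim
-- for n ≥ 2.  With W(x) = 1 + (q - 1)x one has W([n]_q) = qⁿ and
-- [n]_q|_{q=1/q} = q[n]_q / qⁿ, so a power of W turns the difference of
-- the two sides at x = [n]_q into a polynomial function of x.  It vanishes
-- at the infinitely many distinct points [n]_q, n ≥ 2, hence everywhere,
-- in particular at [n]_q for every integer n.

module Submission where

open import Defs hiding (_≈_)
open import Level using (0ℓ; _⊔_)
open import Data.Nat as ℕ using (ℕ; zero; suc; _≤_; _∸_; z≤n; s≤s)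
import Data.Nat.Properties as ℕ
open import Data.Integer as ℤ using (ℤ; +_; -[1+_]; _⊖_)
import Data.Integer.Properties as ℤ
import Data.Integer.Tactic.RingSolver as ℤ-Solver
open import Data.Bool using (Bool; true; false; if_then_else_; _∧_)
import Data.Bool.Properties as Bool
open import Data.Empty using (⊥-elim)
open import Data.Fin using (Fin)
open import Data.List as List using (List; []; _∷_; _∷ʳ_; _++_; reverse; length; foldr; concatMap; allFin)
import Data.List.Properties as List
open import Data.List.Relation.Unary.All using (All; []; _∷_)
open import Data.Maybe as Maybe using ()
open import Data.Product using (_×_; _,_; proj₁; proj₂)
open import Data.Sum as Sum using (_⊎_; inj₁; inj₂)
open import Data.Vec as Vec using (Vec; []; _∷_)
import Data.Vec.Properties as Vec
open import Function using (flip; _∘_; id)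
open import Relation.Nullary using (¬_; Dec; yes; no)
open import Relation.Nullary.Decidable using (dec⇒maybe; ⌊_⌋)
open import Relation.Nullary.Recomputable using (¬-recompute)
open import Relation.Binary using (Rel; Decidable; IsDecPartialOrder; IsEquivalence; Setoid)
import Relation.Binary.Construct.Flip.Ord as Flip
open import Relation.Binary.PropositionalEquality as ≡ using (_≡_; refl; cong; cong₂)
import Relation.Binary.Reasoning.Setoid as SetoidReasoning
open import Algebra.Bundles using (CommutativeRing)
open import Algebra.Morphism.Structures using (module RingMorphisms)
import Algebra.Properties.CommutativeSemigroup as CommutativeSemigroup
import Algebra.Properties.CommutativeSemiring.Exp as Exp
open import Tactic.RingSolver using (solve-∀)
open import Tactic.RingSolver.Core.AlmostCommutativeRing using (AlmostCommutativeRing; fromCommutativeRing)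

-- ≈ₚ wrapped in a record, so that the reflective ring solver sees a
-- binary relation rather than a Π-type.
infix 4 _≋_
record _≋_ (p r : Poly) : Set where
  constructor mk≋
  field coeff-≡ : p ≈ₚ r
open _≋_

≋-isEquivalence : IsEquivalence _≋_
≋-isEquivalence = record
  { refl  = mk≋ λ _ → refl
  ; sym   = λ e → mk≋ λ i → ≡.sym (coeff-≡ e i)
  ; trans = λ e f → mk≋ λ i → ≡.trans (coeff-≡ e i) (coeff-≡ f i)
  }

≋-setoid : Setoid 0ℓ 0ℓ
≋-setoid = record { isEquivalence = ≋-isEquivalence }

open IsEquivalence ≋-isEquivalence
  using () renaming (refl to ≋-refl; sym to ≋-sym; trans to ≋-trans)

coeff-+ₚ : ∀ p r i → coeff (p +ₚ r) i ≡ coeff p i ℤ.+ coeff r i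
coeff-+ₚ []      r       i       = ≡.sym (ℤ.+-identityˡ _)
coeff-+ₚ (a ∷ p) []      i       = ≡.sym (ℤ.+-identityʳ _)
coeff-+ₚ (a ∷ p) (b ∷ r) zero    = refl
coeff-+ₚ (a ∷ p) (b ∷ r) (suc i) = coeff-+ₚ p r i

coeff-·ₚ : ∀ a p i → coeff (a ·ₚ p) i ≡ a ℤ.* coeff p i
coeff-·ₚ a []      i       = ≡.sym (ℤ.*-zeroʳ a)
coeff-·ₚ a (b ∷ p) zero    = refl
coeff-·ₚ a (b ∷ p) (suc i) = coeff-·ₚ a p i

coeff--ₚ : ∀ p i → coeff (-ₚ p) i ≡ ℤ.- coeff p i
coeff--ₚ []      i       = refl
coeff--ₚ (b ∷ p) zero    = refl
coeff--ₚ (b ∷ p) (suc i) = coeff--ₚ p i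

∷-cong : ∀ {a b p r} → a ≡ b → p ≋ r → a ∷ p ≋ b ∷ r
∷-cong a≡b p≋r = mk≋ λ { zero → a≡b ; (suc i) → coeff-≡ p≋r i }

∷-≋-tail : ∀ {a b p r} → a ∷ p ≋ b ∷ r → p ≋ r
∷-≋-tail e = mk≋ λ i → coeff-≡ e (suc i)

∷-≋-[] : ∀ {a p} → a ∷ p ≋ [] → a ≡ + 0 × p ≋ []
∷-≋-[] e = coeff-≡ e zero , mk≋ λ i → coeff-≡ e (suc i)

∷-≋-[]⁺ : ∀ {a p} → a ≡ + 0 → p ≋ [] → a ∷ p ≋ []
∷-≋-[]⁺ a≡0 p≋0 = mk≋ λ { zero → a≡0 ; (suc i) → coeff-≡ p≋0 i }

+ₚ-cong : ∀ {p p' r r'} → p ≋ p' → r ≋ r' → p +ₚ r ≋ p' +ₚ r'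
+ₚ-cong {p} {p'} {r} {r'} e f = mk≋ λ i → ≡.trans (coeff-+ₚ p r i)
  (≡.trans (cong₂ ℤ._+_ (coeff-≡ e i) (coeff-≡ f i)) (≡.sym (coeff-+ₚ p' r' i)))

+ₚ-comm : ∀ p r → p +ₚ r ≋ r +ₚ p
+ₚ-comm p r = mk≋ λ i → ≡.trans (coeff-+ₚ p r i)
  (≡.trans (ℤ.+-comm (coeff p i) _) (≡.sym (coeff-+ₚ r p i)))

+ₚ-assoc : ∀ p r s → (p +ₚ r) +ₚ s ≋ p +ₚ (r +ₚ s)
+ₚ-assoc p r s = mk≋ λ i → begin
  coeff ((p +ₚ r) +ₚ s) i                 ≡⟨ coeff-+ₚ (p +ₚ r) s i ⟩
  coeff (p +ₚ r) i ℤ.+ coeff s i          ≡⟨ ≡.cong (ℤ._+ coeff s i) (coeff-+ₚ p r i) ⟩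
  (coeff p i ℤ.+ coeff r i) ℤ.+ coeff s i ≡⟨ ℤ.+-assoc (coeff p i) _ _ ⟩
  coeff p i ℤ.+ (coeff r i ℤ.+ coeff s i) ≡⟨ ≡.cong (ℤ._+_ (coeff p i)) (coeff-+ₚ r s i) ⟨
  coeff p i ℤ.+ coeff (r +ₚ s) i          ≡⟨ coeff-+ₚ p (r +ₚ s) i ⟨
  coeff (p +ₚ (r +ₚ s)) i                 ∎
  where open ≡.≡-Reasoning

+ₚ-identityʳ : ∀ p → p +ₚ [] ≋ p
+ₚ-identityʳ p = mk≋ λ i → ≡.trans (coeff-+ₚ p [] i) (ℤ.+-identityʳ _)

-ₚ-inverseˡ : ∀ p → (-ₚ p) +ₚ p ≋ []
-ₚ-inverseˡ p = mk≋ λ i → ≡.trans (coeff-+ₚ (-ₚ p) p i)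
  (≡.trans (≡.cong (ℤ._+ coeff p i) (coeff--ₚ p i)) (ℤ.+-inverseˡ (coeff p i)))

-ₚ-cong : ∀ {p p'} → p ≋ p' → -ₚ p ≋ -ₚ p'
-ₚ-cong {p} {p'} e = mk≋ λ i → ≡.trans (coeff--ₚ p i)
  (≡.trans (≡.cong ℤ.-_ (coeff-≡ e i)) (≡.sym (coeff--ₚ p' i)))

+ₚ-interchange : ∀ p r s t → (p +ₚ r) +ₚ (s +ₚ t) ≋ (p +ₚ s) +ₚ (r +ₚ t)
+ₚ-interchange p r s t = mk≋ λ i →
  ≡.trans (expand p r s t i) (≡.trans (interchange (coeff p i) (coeff r i) (coeff s i) (coeff t i)) (≡.sym (expand p s r t i)))
  where
  expand : ∀ p r s t i → coeff ((p +ₚ r) +ₚ (s +ₚ t)) i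
                       ≡ (coeff p i ℤ.+ coeff r i) ℤ.+ (coeff s i ℤ.+ coeff t i)
  expand p r s t i = ≡.trans (coeff-+ₚ (p +ₚ r) (s +ₚ t) i)
    (cong₂ ℤ._+_ (coeff-+ₚ p r i) (coeff-+ₚ s t i))
  interchange : ∀ a b c d → (a ℤ.+ b) ℤ.+ (c ℤ.+ d) ≡ (a ℤ.+ c) ℤ.+ (b ℤ.+ d)
  interchange = ℤ-Solver.solve-∀

·ₚ-cong : ∀ {a b p r} → a ≡ b → p ≋ r → a ·ₚ p ≋ b ·ₚ r
·ₚ-cong {a} {b} {p} {r} a≡b e = mk≋ λ i → ≡.trans (coeff-·ₚ a p i)
  (≡.trans (cong₂ ℤ._*_ a≡b (coeff-≡ e i)) (≡.sym (coeff-·ₚ b r i)))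

·ₚ-zeroˡ : ∀ {a} p → a ≡ + 0 → a ·ₚ p ≋ []
·ₚ-zeroˡ p refl = mk≋ λ i → ≡.trans (coeff-·ₚ (+ 0) p i) (ℤ.*-zeroˡ (coeff p i))

·ₚ-identityˡ : ∀ p → (+ 1) ·ₚ p ≋ p
·ₚ-identityˡ p = mk≋ λ i → ≡.trans (coeff-·ₚ (+ 1) p i) (ℤ.*-identityˡ _)

·ₚ-distrib-+ₚ : ∀ a p r → a ·ₚ (p +ₚ r) ≋ (a ·ₚ p) +ₚ (a ·ₚ r)
·ₚ-distrib-+ₚ a p r = mk≋ λ i → begin
  coeff (a ·ₚ (p +ₚ r)) i                        ≡⟨ coeff-·ₚ a (p +ₚ r) i ⟩
  a ℤ.* coeff (p +ₚ r) i                         ≡⟨ ≡.cong (a ℤ.*_) (coeff-+ₚ p r i) ⟩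
  a ℤ.* (coeff p i ℤ.+ coeff r i)                ≡⟨ ℤ.*-distribˡ-+ a (coeff p i) _ ⟩
  a ℤ.* coeff p i ℤ.+ a ℤ.* coeff r i            ≡⟨ cong₂ ℤ._+_ (coeff-·ₚ a p i) (coeff-·ₚ a r i) ⟨
  coeff (a ·ₚ p) i ℤ.+ coeff (a ·ₚ r) i          ≡⟨ coeff-+ₚ (a ·ₚ p) (a ·ₚ r) i ⟨
  coeff ((a ·ₚ p) +ₚ (a ·ₚ r)) i                 ∎
  where open ≡.≡-Reasoning

+-distrib-·ₚ : ∀ a b p → (a ℤ.+ b) ·ₚ p ≋ (a ·ₚ p) +ₚ (b ·ₚ p)
+-distrib-·ₚ a b p = mk≋ λ i → begin
  coeff ((a ℤ.+ b) ·ₚ p) i                ≡⟨ coeff-·ₚ (a ℤ.+ b) p i ⟩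
  (a ℤ.+ b) ℤ.* coeff p i                 ≡⟨ ℤ.*-distribʳ-+ (coeff p i) a b ⟩
  a ℤ.* coeff p i ℤ.+ b ℤ.* coeff p i     ≡⟨ cong₂ ℤ._+_ (coeff-·ₚ a p i) (coeff-·ₚ b p i) ⟨
  coeff (a ·ₚ p) i ℤ.+ coeff (b ·ₚ p) i   ≡⟨ coeff-+ₚ (a ·ₚ p) (b ·ₚ p) i ⟨
  coeff ((a ·ₚ p) +ₚ (b ·ₚ p)) i          ∎
  where open ≡.≡-Reasoning

·ₚ-assoc : ∀ a b p → a ·ₚ (b ·ₚ p) ≋ (a ℤ.* b) ·ₚ p
·ₚ-assoc a b p = mk≋ λ i → begin
  coeff (a ·ₚ (b ·ₚ p)) i   ≡⟨ coeff-·ₚ a (b ·ₚ p) i ⟩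
  a ℤ.* coeff (b ·ₚ p) i    ≡⟨ ≡.cong (a ℤ.*_) (coeff-·ₚ b p i) ⟩
  a ℤ.* (b ℤ.* coeff p i)   ≡⟨ ℤ.*-assoc a b _ ⟨
  (a ℤ.* b) ℤ.* coeff p i   ≡⟨ coeff-·ₚ (a ℤ.* b) p i ⟨
  coeff ((a ℤ.* b) ·ₚ p) i  ∎
  where open ≡.≡-Reasoning

module ≋-Reasoning = SetoidReasoning ≋-setoid

*ₚ-zeroˡ : ∀ {p} r → p ≋ [] → p *ₚ r ≋ []
*ₚ-zeroˡ {[]}    r e = ≋-refl
*ₚ-zeroˡ {a ∷ p} r e with ∷-≋-[] e
... | a≡0 , p≋0 = +ₚ-cong (·ₚ-zeroˡ r a≡0) (∷-≋-[]⁺ refl (*ₚ-zeroˡ r p≋0))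

*ₚ-zeroʳ : ∀ p → p *ₚ [] ≋ []
*ₚ-zeroʳ []      = ≋-refl
*ₚ-zeroʳ (a ∷ p) = ∷-≋-[]⁺ refl (*ₚ-zeroʳ p)

*ₚ-congˡ : ∀ {p p'} r → p ≋ p' → p *ₚ r ≋ p' *ₚ r
*ₚ-congˡ {[]}    {p'}     r e = ≋-sym (*ₚ-zeroˡ r (≋-sym e))
*ₚ-congˡ {a ∷ p} {[]}     r e = *ₚ-zeroˡ r e
*ₚ-congˡ {a ∷ p} {b ∷ p'} r e =
  +ₚ-cong (·ₚ-cong (coeff-≡ e zero) ≋-refl) (∷-cong refl (*ₚ-congˡ r (∷-≋-tail e)))

*ₚ-congʳ : ∀ p {r r'} → r ≋ r' → p *ₚ r ≋ p *ₚ r'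
*ₚ-congʳ []      e = ≋-refl
*ₚ-congʳ (a ∷ p) e = +ₚ-cong (·ₚ-cong {a} refl e) (∷-cong refl (*ₚ-congʳ p e))

∷-*ₚ : ∀ {a} p r → a ≡ + 0 → (a ∷ p) *ₚ r ≋ + 0 ∷ (p *ₚ r)
∷-*ₚ p r a≡0 = +ₚ-cong (·ₚ-zeroˡ r a≡0) ≋-refl

*ₚ-distribʳ : ∀ p p' r → (p +ₚ p') *ₚ r ≋ (p *ₚ r) +ₚ (p' *ₚ r)
*ₚ-distribʳ []      p'       r = ≋-refl
*ₚ-distribʳ (a ∷ p) []       r = ≋-sym (+ₚ-identityʳ _)
*ₚ-distribʳ (a ∷ p) (b ∷ p') r = begin
  ((a ℤ.+ b) ·ₚ r) +ₚ (+ 0 ∷ ((p +ₚ p') *ₚ r))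
    ≈⟨ +ₚ-cong (+-distrib-·ₚ a b r) (∷-cong refl (*ₚ-distribʳ p p' r)) ⟩
  ((a ·ₚ r) +ₚ (b ·ₚ r)) +ₚ ((+ 0 ∷ (p *ₚ r)) +ₚ (+ 0 ∷ (p' *ₚ r)))
    ≈⟨ +ₚ-interchange (a ·ₚ r) (b ·ₚ r) (+ 0 ∷ (p *ₚ r)) (+ 0 ∷ (p' *ₚ r)) ⟩
  ((a ·ₚ r) +ₚ (+ 0 ∷ (p *ₚ r))) +ₚ ((b ·ₚ r) +ₚ (+ 0 ∷ (p' *ₚ r))) ∎
  where open ≋-Reasoning

·ₚ-*ₚ : ∀ a r s → (a ·ₚ r) *ₚ s ≋ a ·ₚ (r *ₚ s)
·ₚ-*ₚ a []      s = ≋-refl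
·ₚ-*ₚ a (b ∷ r) s = begin
  ((a ℤ.* b) ·ₚ s) +ₚ (+ 0 ∷ ((a ·ₚ r) *ₚ s))
    ≈⟨ +ₚ-cong (≋-sym (·ₚ-assoc a b s)) (∷-cong (≡.sym (ℤ.*-zeroʳ a)) (·ₚ-*ₚ a r s)) ⟩
  (a ·ₚ (b ·ₚ s)) +ₚ (a ·ₚ (+ 0 ∷ (r *ₚ s)))
    ≈⟨ ·ₚ-distrib-+ₚ a (b ·ₚ s) (+ 0 ∷ (r *ₚ s)) ⟨
  a ·ₚ ((b ·ₚ s) +ₚ (+ 0 ∷ (r *ₚ s))) ∎
  where open ≋-Reasoning

*ₚ-assoc : ∀ p r s → (p *ₚ r) *ₚ s ≋ p *ₚ (r *ₚ s)
*ₚ-assoc []      r s = ≋-refl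
*ₚ-assoc (a ∷ p) r s = begin
  ((a ·ₚ r) +ₚ (+ 0 ∷ (p *ₚ r))) *ₚ s         ≈⟨ *ₚ-distribʳ (a ·ₚ r) (+ 0 ∷ (p *ₚ r)) s ⟩
  ((a ·ₚ r) *ₚ s) +ₚ ((+ 0 ∷ (p *ₚ r)) *ₚ s)  ≈⟨ +ₚ-cong (·ₚ-*ₚ a r s) (∷-*ₚ (p *ₚ r) s refl) ⟩
  (a ·ₚ (r *ₚ s)) +ₚ (+ 0 ∷ ((p *ₚ r) *ₚ s))  ≈⟨ +ₚ-cong ≋-refl (∷-cong refl (*ₚ-assoc p r s)) ⟩
  (a ·ₚ (r *ₚ s)) +ₚ (+ 0 ∷ (p *ₚ (r *ₚ s)))  ∎
  where open ≋-Reasoning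

*ₚ-∷ʳ : ∀ p b r → p *ₚ (b ∷ r) ≋ (b ·ₚ p) +ₚ (+ 0 ∷ (p *ₚ r))
*ₚ-∷ʳ []      b r = ≋-sym (∷-≋-[]⁺ refl ≋-refl)
*ₚ-∷ʳ (a ∷ p) b r = ∷-cong ab≡ba (begin
  (a ·ₚ r) +ₚ (p *ₚ (b ∷ r))                      ≈⟨ +ₚ-cong ≋-refl (*ₚ-∷ʳ p b r) ⟩
  (a ·ₚ r) +ₚ ((b ·ₚ p) +ₚ (+ 0 ∷ (p *ₚ r)))      ≈⟨ +ₚ-assoc (a ·ₚ r) (b ·ₚ p) _ ⟨
  ((a ·ₚ r) +ₚ (b ·ₚ p)) +ₚ (+ 0 ∷ (p *ₚ r))      ≈⟨ +ₚ-cong (+ₚ-comm (a ·ₚ r) (b ·ₚ p)) ≋-refl ⟩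
  ((b ·ₚ p) +ₚ (a ·ₚ r)) +ₚ (+ 0 ∷ (p *ₚ r))      ≈⟨ +ₚ-assoc (b ·ₚ p) (a ·ₚ r) _ ⟩
  (b ·ₚ p) +ₚ ((a ·ₚ r) +ₚ (+ 0 ∷ (p *ₚ r)))      ∎)
  where
  open ≋-Reasoning
  ab≡ba : a ℤ.* b ℤ.+ + 0 ≡ b ℤ.* a ℤ.+ + 0
  ab≡ba = ≡.cong (ℤ._+ + 0) (ℤ.*-comm a b)

*ₚ-comm : ∀ p r → p *ₚ r ≋ r *ₚ p
*ₚ-comm p []      = *ₚ-zeroʳ p
*ₚ-comm p (b ∷ r) = ≋-trans (*ₚ-∷ʳ p b r) (+ₚ-cong ≋-refl (∷-cong refl (*ₚ-comm p r)))

*ₚ-identityˡ : ∀ p → mono 0 *ₚ p ≋ p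
*ₚ-identityˡ p = ≋-trans (+ₚ-cong (·ₚ-identityˡ p) (∷-≋-[]⁺ refl ≋-refl)) (+ₚ-identityʳ p)

*ₚ-distribˡ : ∀ p r s → p *ₚ (r +ₚ s) ≋ (p *ₚ r) +ₚ (p *ₚ s)
*ₚ-distribˡ p r s = ≋-trans (*ₚ-comm p _)
  (≋-trans (*ₚ-distribʳ r s p) (+ₚ-cong (*ₚ-comm r p) (*ₚ-comm s p)))

ℤ[q] : CommutativeRing 0ℓ 0ℓ
ℤ[q] = record
  { Carrier = Poly ; _≈_ = _≋_ ; _+_ = _+ₚ_ ; _*_ = _*ₚ_ ; -_ = -ₚ_ ; 0# = [] ; 1# = mono 0
  ; isCommutativeRing = record
    { isRing = record
      { +-isAbelianGroup = record
        { isGroup = record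
          { isMonoid = record
            { isSemigroup = record
              { isMagma = record { isEquivalence = ≋-isEquivalence ; ∙-cong = +ₚ-cong }
              ; assoc = +ₚ-assoc }
            ; identity = (λ _ → ≋-refl) , +ₚ-identityʳ }
          ; inverse = -ₚ-inverseˡ , λ p → ≋-trans (+ₚ-comm p (-ₚ p)) (-ₚ-inverseˡ p)
          ; ⁻¹-cong = -ₚ-cong }
        ; comm = +ₚ-comm }
      ; *-cong = λ {p} {p'} {r} e f → ≋-trans (*ₚ-congˡ r e) (*ₚ-congʳ p' f)
      ; *-assoc = *ₚ-assoc
      ; *-identity = *ₚ-identityˡ , λ p → ≋-trans (*ₚ-comm p _) (*ₚ-identityˡ p)
      ; distrib = *ₚ-distribˡ , λ r p s → *ₚ-distribʳ p s r }
    ; *-comm = *ₚ-comm } }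

≋[]? : ∀ p → Dec (p ≋ [])
≋[]? []      = yes ≋-refl
≋[]? (a ∷ p) with a ℤ.≟ + 0 | ≋[]? p
... | yes a≡0 | yes p≋0 = yes (∷-≋-[]⁺ a≡0 p≋0)
... | no a≢0  | _       = no λ e → a≢0 (proj₁ (∷-≋-[] e))
... | yes _   | no p≉0  = no λ e → p≉0 (proj₂ (∷-≋-[] e))

ℤ[q]-ACR : AlmostCommutativeRing 0ℓ 0ℓ
ℤ[q]-ACR = fromCommutativeRing ℤ[q] λ p → Maybe.map ≋-sym (dec⇒maybe (≋[]? p))

*ₚ-∷ : ∀ {b} p r → b ≡ + 0 → p *ₚ (b ∷ r) ≋ + 0 ∷ (p *ₚ r)
*ₚ-∷ p r b≡0 = ≋-trans (*ₚ-∷ʳ p _ r) (+ₚ-cong (·ₚ-zeroˡ p b≡0) ≋-refl)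

*ₚ-zero-divisor : ∀ p r → p *ₚ r ≋ [] → p ≋ [] ⊎ r ≋ []
*ₚ-zero-divisor []      r       e = inj₁ ≋-refl
*ₚ-zero-divisor (a ∷ p) []      e = inj₂ ≋-refl
*ₚ-zero-divisor (a ∷ p) (b ∷ r) e = Sum.[
    (λ a≡0 → Sum.map₁ (∷-≋-[]⁺ a≡0) (*ₚ-zero-divisor p (b ∷ r)
      (proj₂ (∷-≋-[] (≋-trans (≋-sym (∷-*ₚ p (b ∷ r) a≡0)) e))))) ,
    (λ b≡0 → Sum.map₂ (∷-≋-[]⁺ b≡0) (*ₚ-zero-divisor (a ∷ p) r
      (proj₂ (∷-≋-[] (≋-trans (≋-sym (*ₚ-∷ (a ∷ p) r b≡0)) e))))) ]
  (ℤ.i*j≡0⇒i≡0∨j≡0 a (≡.trans (≡.sym (ℤ.+-identityʳ (a ℤ.* b))) (coeff-≡ e zero)))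

∷ʳ-≋-[] : ∀ p a → p ∷ʳ a ≋ [] → p ≋ [] × a ≡ + 0
∷ʳ-≋-[] []      a e = ≋-refl , proj₁ (∷-≋-[] e)
∷ʳ-≋-[] (b ∷ p) a e =
  let b≡0 , rest = ∷-≋-[] e ; p≋0 , a≡0 = ∷ʳ-≋-[] p a rest in ∷-≋-[]⁺ b≡0 p≋0 , a≡0

reverse-≋-[] : ∀ p → reverse p ≋ [] → p ≋ []
reverse-≋-[] []      e = e
reverse-≋-[] (a ∷ p) e =
  let rp≋0 , a≡0 = ∷ʳ-≋-[] (reverse p) a (≡.subst (_≋ []) (List.unfold-reverse a p) e)
  in ∷-≋-[]⁺ a≡0 (reverse-≋-[] p rp≋0)

mono1-*ₚ : ∀ p → mono 1 *ₚ p ≋ + 0 ∷ p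
mono1-*ₚ p = ≋-trans (∷-*ₚ (mono 0) p refl) (∷-cong refl (*ₚ-identityˡ p))

mono-nonzero : ∀ m → ¬ mono m ≋ []
mono-nonzero zero    e with coeff-≡ e zero
... | ()
mono-nonzero (suc m) e = mono-nonzero m (proj₂ (∷-≋-[] e))

mono-injective : ∀ {m n} → mono m ≋ mono n → m ≡ n
mono-injective {zero}  {zero}  e = refl
mono-injective {zero}  {suc n} e with coeff-≡ e 0
... | ()
mono-injective {suc m} {zero}  e with coeff-≡ e 0
... | ()
mono-injective {suc m} {suc n} e = cong suc (mono-injective (∷-≋-tail e))

module CommutativeRingLemmas {c ℓ} (R : CommutativeRing c ℓ) where

  open CommutativeRing R hiding (zero) renaming (refl to ≈-refl)
  open Exp commutativeSemiring public using (_^_; ^-congˡ; ^-homo-*)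
  open SetoidReasoning setoid

  open import Algebra.Properties.Group +-group using (x∙y⁻¹≈ε⇒x≈y; x≈y⇒x∙y⁻¹≈ε)
  open import Algebra.Properties.Ring ring using ([y-z]x≈yx-zx; -1*x≈-x)
  open CommutativeSemigroup *-commutativeSemigroup
    using (interchange; x∙yz≈yx∙z) renaming (x∙yz≈y∙xz to *-leftComm)
  open CommutativeSemigroup +-commutativeSemigroup
    using () renaming (x∙yz≈y∙xz to +-leftComm; interchange to +-interchange)

  inverse-unique : ∀ {x y z} → x * y ≈ 1# → x * z ≈ 1# → y ≈ z
  inverse-unique {x} {y} {z} xy≈1 xz≈1 = begin
    y              ≈⟨ *-identityʳ y ⟨
    y * 1#         ≈⟨ *-congˡ xz≈1 ⟨
    y * (x * z)    ≈⟨ x∙yz≈yx∙z y x z ⟩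
    (x * y) * z    ≈⟨ *-congʳ xy≈1 ⟩
    1# * z         ≈⟨ *-identityˡ z ⟩
    z              ∎

  module UnitPowers (u v : Carrier) (uv≈1 : u * v ≈ 1#) where

    pow : ℤ → Carrier
    pow (+ m)    = u ^ m
    pow -[1+ m ] = v ^ suc m

    u^m*v^m≈1 : ∀ m → u ^ m * v ^ m ≈ 1#
    u^m*v^m≈1 zero    = *-identityˡ 1#
    u^m*v^m≈1 (suc m) = begin
      (u * u ^ m) * (v * v ^ m)  ≈⟨ interchange u (u ^ m) v (v ^ m) ⟩
      (u * v) * (u ^ m * v ^ m)  ≈⟨ *-cong uv≈1 (u^m*v^m≈1 m) ⟩
      1# * 1#                    ≈⟨ *-identityˡ 1# ⟩
      1#                         ∎

    pow-⊖ : ∀ i j → pow (i ⊖ j) ≈ u ^ i * v ^ j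
    pow-⊖ zero    zero    = sym (*-identityˡ 1#)
    pow-⊖ zero    (suc j) = sym (*-identityˡ _)
    pow-⊖ (suc i) zero    = sym (*-identityʳ _)
    pow-⊖ (suc i) (suc j) = begin
      pow (suc i ⊖ suc j)         ≡⟨ ≡.cong pow (ℤ.[1+m]⊖[1+n]≡m⊖n i j) ⟩
      pow (i ⊖ j)                 ≈⟨ pow-⊖ i j ⟩
      u ^ i * v ^ j               ≈⟨ *-identityˡ _ ⟨
      1# * (u ^ i * v ^ j)        ≈⟨ *-congʳ uv≈1 ⟨
      (u * v) * (u ^ i * v ^ j)   ≈⟨ interchange u v (u ^ i) (v ^ j) ⟩
      (u * u ^ i) * (v * v ^ j)   ∎

    pow-+ : ∀ a b → pow (a ℤ.+ b) ≈ pow a * pow b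
    pow-+ (+ m)    (+ n)    = ^-homo-* u m n
    pow-+ (+ m)    -[1+ n ] = pow-⊖ m (suc n)
    pow-+ -[1+ m ] (+ n)    = trans (pow-⊖ n (suc m)) (*-comm _ _)
    pow-+ -[1+ m ] -[1+ n ] = begin
      v ^ suc (suc (m ℕ.+ n))     ≡⟨ ≡.cong (λ k → v ^ suc k) (ℕ.+-suc m n) ⟨
      v ^ (suc m ℕ.+ suc n)       ≈⟨ ^-homo-* v (suc m) (suc n) ⟩
      v ^ suc m * v ^ suc n       ∎

    pow-*ℕ : ∀ a k → pow (a ℤ.* + k) ≈ pow a ^ k
    pow-*ℕ a zero    = reflexive (≡.cong pow (ℤ.*-zeroʳ a))
    pow-*ℕ a (suc k) = begin
      pow (a ℤ.* + suc k)      ≡⟨ ≡.cong pow a*[1+k]≡a+a*k ⟩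
      pow (a ℤ.+ a ℤ.* + k)    ≈⟨ pow-+ a (a ℤ.* + k) ⟩
      pow a * pow (a ℤ.* + k)  ≈⟨ *-congˡ (pow-*ℕ a k) ⟩
      pow a * pow a ^ k        ∎
      where
      a*[1+k]≡a+a*k : a ℤ.* + suc k ≡ a ℤ.+ a ℤ.* + k
      a*[1+k]≡a+a*k = ≡.trans (ℤ.*-distribˡ-+ a (+ 1) (+ k)) (≡.cong (ℤ._+ a ℤ.* + k) (ℤ.*-identityʳ a))

  eval : List Carrier → Carrier → Carrier
  eval []       x = 0#
  eval (c ∷ cs) x = c + x * eval cs x

  eval-congʳ : ∀ cs {x y} → x ≈ y → eval cs x ≈ eval cs y
  eval-congʳ []       x≈y = ≈-refl
  eval-congʳ (c ∷ cs) x≈y = +-congˡ (*-cong x≈y (eval-congʳ cs x≈y))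

  module _ {φ : Carrier → Carrier} (φ-hom : RingMorphisms.IsRingHomomorphism rawRing rawRing φ) where
    open RingMorphisms.IsRingHomomorphism φ-hom

    eval-homo : ∀ cs x → φ (eval cs x) ≈ eval (List.map φ cs) (φ x)
    eval-homo []       x = 0#-homo
    eval-homo (c ∷ cs) x = begin
      φ (c + x * eval cs x)                   ≈⟨ +-homo c (x * eval cs x) ⟩
      φ c + φ (x * eval cs x)                 ≈⟨ +-congˡ (*-homo x (eval cs x)) ⟩
      φ c + φ x * φ (eval cs x)               ≈⟨ +-congˡ (*-congˡ (eval-homo cs x)) ⟩
      φ c + φ x * eval (List.map φ cs) (φ x)  ∎

    homo-^ : ∀ x m → φ (x ^ m) ≈ φ x ^ m
    homo-^ x zero    = 1#-homo
    homo-^ x (suc m) = trans (*-homo x (x ^ m)) (*-congˡ (homo-^ x m))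

  -- v ^ k * eval cs (u / v), without the division; the clause for
  -- k = 0 is junk, used only when cs is longer than k.
  homogenise : ℕ → List Carrier → Carrier → Carrier → Carrier
  homogenise k       []       u v = 0#
  homogenise zero    (c ∷ cs) u v = 0#
  homogenise (suc k) (c ∷ cs) u v = c * v ^ suc k + u * homogenise k cs u v

  homogenise-eval : ∀ k cs {u v w} → v * w ≈ 1# → length cs ≤ k →
                    homogenise k cs u v ≈ v ^ k * eval cs (u * w)
  homogenise-eval k       []       {v = v} vw≈1 _ = sym (zeroʳ (v ^ k))
  homogenise-eval (suc k) (c ∷ cs) {u} {v} {w} vw≈1 (s≤s len≤k) = begin
    c * v ^ suc k + u * homogenise k cs u v        ≈⟨ +-congˡ (*-congˡ (homogenise-eval k cs vw≈1 len≤k)) ⟩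
    c * v ^ suc k + u * (v ^ k * e)                ≈⟨ +-cong (*-comm (v ^ suc k) c) (*-identityˡ _) ⟨
    v ^ suc k * c + 1# * (u * (v ^ k * e))         ≈⟨ +-congˡ (*-congʳ vw≈1) ⟨
    v ^ suc k * c + (v * w) * (u * (v ^ k * e))    ≈⟨ +-congˡ (rearrange v (v ^ k) u w e) ⟩
    v ^ suc k * c + v ^ suc k * ((u * w) * e)      ≈⟨ distribˡ (v ^ suc k) c _ ⟨
    v ^ suc k * (c + (u * w) * e)                  ∎
    where
    e = eval cs (u * w)
    rearrange : ∀ v vᵏ u w e → (v * w) * (u * (vᵏ * e)) ≈ (v * vᵏ) * ((u * w) * e)
    rearrange = solve 5 (λ v vᵏ u w e → (v ⊕ w) ⊕ (u ⊕ (vᵏ ⊕ e)) ⊜ (v ⊕ vᵏ) ⊕ ((u ⊕ w) ⊕ e)) ≈-refl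
      where open import Algebra.Solver.CommutativeMonoid *-commutativeMonoid

  sumOver : ∀ {a} {A : Set a} → List A → (A → Carrier) → Carrier
  sumOver []       f = 0#
  sumOver (x ∷ xs) f = f x + sumOver xs f

  syntax sumOver xs (λ x → e) = ∑[ x ∈ xs ] e

  module _ {a} {A : Set a} where

    sum-cong : ∀ (xs : List A) {f g} → (∀ x → f x ≈ g x) → sumOver xs f ≈ sumOver xs g
    sum-cong []       f≈g = ≈-refl
    sum-cong (x ∷ xs) f≈g = +-cong (f≈g x) (sum-cong xs f≈g)

    sum-++ : ∀ (xs ys : List A) f → sumOver (xs ++ ys) f ≈ sumOver xs f + sumOver ys f
    sum-++ []       ys f = sym (+-identityˡ _)
    sum-++ (x ∷ xs) ys f = trans (+-congˡ (sum-++ xs ys f)) (sym (+-assoc (f x) _ _))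

    sum-+ : ∀ (xs : List A) f g → ∑[ x ∈ xs ] (f x + g x) ≈ sumOver xs f + sumOver xs g
    sum-+ []       f g = sym (+-identityˡ 0#)
    sum-+ (x ∷ xs) f g = trans (+-congˡ (sum-+ xs f g)) (+-interchange (f x) (g x) _ _)

    sum-*ˡ : ∀ (xs : List A) c f → ∑[ x ∈ xs ] (c * f x) ≈ c * sumOver xs f
    sum-*ˡ []       c f = sym (zeroʳ c)
    sum-*ˡ (x ∷ xs) c f = trans (+-congˡ (sum-*ˡ xs c f)) (sym (distribˡ c (f x) _))

    sum-0 : ∀ (xs : List A) → ∑[ x ∈ xs ] 0# ≈ 0#
    sum-0 []       = ≈-refl
    sum-0 (x ∷ xs) = trans (+-identityˡ _) (sum-0 xs)

  sum-map : ∀ {a b} {A : Set a} {B : Set b} (g : A → B) xs f →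
            sumOver (List.map g xs) f ≈ ∑[ x ∈ xs ] f (g x)
  sum-map g []       f = ≈-refl
  sum-map g (x ∷ xs) f = +-congˡ (sum-map g xs f)

  sum-concatMap : ∀ {a b} {A : Set a} {B : Set b} (g : A → List B) xs f →
                  sumOver (concatMap g xs) f ≈ ∑[ x ∈ xs ] sumOver (g x) f
  sum-concatMap g []       f = ≈-refl
  sum-concatMap g (x ∷ xs) f = trans (sum-++ (g x) (concatMap g xs) f) (+-congˡ (sum-concatMap g xs f))

  sum-swap : ∀ {a b} {A : Set a} {B : Set b} (xs : List A) (ys : List B) (f : A → B → Carrier) →
             ∑[ x ∈ xs ] ∑[ y ∈ ys ] f x y ≈ ∑[ y ∈ ys ] ∑[ x ∈ xs ] f x y
  sum-swap []       ys f = sym (sum-0 ys)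
  sum-swap (x ∷ xs) ys f = trans (+-congˡ (sum-swap xs ys f)) (sym (sum-+ ys (f x) _))

  module _ (k : ℕ) where

    sum-allVecs-∷ : ∀ m G → sumOver (allVecs k (suc m)) G ≈ ∑[ i ∈ allFin k ] ∑[ w ∈ allVecs k m ] G (i ∷ w)
    sum-allVecs-∷ m G = trans (sum-concatMap _ (allFin k) G)
      (sum-cong (allFin k) λ i → sum-map (i ∷_) (allVecs k m) G)

    sum-allVecs-∷ʳ : ∀ m G → sumOver (allVecs k (suc m)) G ≈ ∑[ i ∈ allFin k ] ∑[ w ∈ allVecs k m ] G (w Vec.∷ʳ i)
    sum-allVecs-∷ʳ zero    G = sum-allVecs-∷ zero G
    sum-allVecs-∷ʳ (suc m) G = begin
      sumOver (allVecs k (suc (suc m))) G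
        ≈⟨ sum-allVecs-∷ (suc m) G ⟩
      ∑[ j ∈ allFin k ] sumOver (allVecs k (suc m)) (λ w → G (j ∷ w))
        ≈⟨ sum-cong (allFin k) (λ j → sum-allVecs-∷ʳ m (λ w → G (j ∷ w))) ⟩
      ∑[ j ∈ allFin k ] ∑[ i ∈ allFin k ] ∑[ w ∈ allVecs k m ] G (j ∷ (w Vec.∷ʳ i))
        ≈⟨ sum-swap (allFin k) (allFin k) (λ j i → ∑[ w ∈ allVecs k m ] G (j ∷ (w Vec.∷ʳ i))) ⟩
      ∑[ i ∈ allFin k ] ∑[ j ∈ allFin k ] ∑[ w ∈ allVecs k m ] G ((j ∷ w) Vec.∷ʳ i)
        ≈⟨ sum-cong (allFin k) (λ i → sum-allVecs-∷ m (λ w → G (w Vec.∷ʳ i))) ⟨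
      ∑[ i ∈ allFin k ] sumOver (allVecs k (suc m)) (λ w → G (w Vec.∷ʳ i)) ∎

    sum-allVecs-reverse : ∀ m G → ∑[ v ∈ allVecs k m ] G (Vec.reverse v) ≈ sumOver (allVecs k m) G
    sum-allVecs-reverse zero    G = ≈-refl
    sum-allVecs-reverse (suc m) G = begin
      ∑[ v ∈ allVecs k (suc m) ] G (Vec.reverse v)
        ≈⟨ sum-allVecs-∷ m _ ⟩
      ∑[ i ∈ allFin k ] ∑[ w ∈ allVecs k m ] G (Vec.reverse (i ∷ w))
        ≈⟨ sum-cong (allFin k) (λ i → sum-cong (allVecs k m) λ w → reflexive (≡.cong G (Vec.reverse-∷ i w))) ⟩
      ∑[ i ∈ allFin k ] ∑[ w ∈ allVecs k m ] G (Vec.reverse w Vec.∷ʳ i)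
        ≈⟨ sum-cong (allFin k) (λ i → sum-allVecs-reverse m (λ w → G (w Vec.∷ʳ i))) ⟩
      ∑[ i ∈ allFin k ] ∑[ w ∈ allVecs k m ] G (w Vec.∷ʳ i)
        ≈⟨ sum-allVecs-∷ʳ m G ⟨
      sumOver (allVecs k (suc m)) G ∎

  -- Polynomial functions

  data IsPolynomial≤ : ℕ → (Carrier → Carrier) → Set (c ⊔ ℓ) where
    const : ∀ a → IsPolynomial≤ 0 (λ _ → a)
    var*  : ∀ {d f} → IsPolynomial≤ d f → IsPolynomial≤ (suc d) (λ y → y * f y)
    add   : ∀ {d f g} → IsPolynomial≤ d f → IsPolynomial≤ d g → IsPolynomial≤ d (λ y → f y + g y)
    scale : ∀ {d f} a → IsPolynomial≤ d f → IsPolynomial≤ d (λ y → a * f y)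
    raise : ∀ {d e f} → d ≤ e → IsPolynomial≤ d f → IsPolynomial≤ e f
    resp  : ∀ {d f g} → (∀ y → f y ≈ g y) → IsPolynomial≤ d f → IsPolynomial≤ d g

  degree-0⇒constant : ∀ {d f} → IsPolynomial≤ d f → d ≡ 0 → ∀ y z → f y ≈ f z
  degree-0⇒constant (const a)       d≡0 y z = ≈-refl
  degree-0⇒constant (add p q)       d≡0 y z = +-cong (degree-0⇒constant p d≡0 y z) (degree-0⇒constant q d≡0 y z)
  degree-0⇒constant (scale a p)     d≡0 y z = *-congˡ (degree-0⇒constant p d≡0 y z)
  degree-0⇒constant (raise d≤e p)   ≡.refl y z = degree-0⇒constant p (ℕ.n≤0⇒n≡0 d≤e) y z
  degree-0⇒constant (resp f≈g p)    d≡0 y z =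
    trans (sym (f≈g y)) (trans (degree-0⇒constant p d≡0 y z) (f≈g z))

  sub : ∀ {d f g} → IsPolynomial≤ d f → IsPolynomial≤ d g → IsPolynomial≤ d (λ y → f y - g y)
  sub p q = add p (resp (λ y → -1*x≈-x _) (scale (- 1#) q))

  affine-* : ∀ a b {d f} → IsPolynomial≤ d f → IsPolynomial≤ (suc d) (λ y → (a + b * y) * f y)
  affine-* a b {d} {f} p = resp expand (add (raise (ℕ.n≤1+n d) (scale a p)) (scale b (var* p)))
    where
    expand : ∀ y → a * f y + b * (y * f y) ≈ (a + b * y) * f y
    expand y = sym (trans (distribʳ (f y) a (b * y)) (+-congˡ (*-assoc b y (f y))))

  affine^-* : ∀ a b k {d f} → IsPolynomial≤ d f → IsPolynomial≤ (k ℕ.+ d) (λ y → (a + b * y) ^ k * f y)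
  affine^-* a b zero    p = resp (λ y → sym (*-identityˡ _)) p
  affine^-* a b (suc k) p = resp (λ y → sym (*-assoc _ _ _)) (affine-* a b (affine^-* a b k p))

  eval-polynomial : ∀ cs → IsPolynomial≤ (length cs) (eval cs)
  eval-polynomial []       = const 0#
  eval-polynomial (c ∷ cs) = add (raise z≤n (const c)) (var* (eval-polynomial cs))

  homogenise-polynomial : ∀ k cs a b a′ b′ →
    IsPolynomial≤ k (λ y → homogenise k cs (a + b * y) (a′ + b′ * y))
  homogenise-polynomial k       []       a b a′ b′ = raise z≤n (const 0#)
  homogenise-polynomial zero    (c ∷ cs) a b a′ b′ = const 0#
  homogenise-polynomial (suc k) (c ∷ cs) a b a′ b′ =
    add (resp (λ y → *-congˡ (*-identityʳ _))
              (scale c (raise (ℕ.≤-reflexive (ℕ.+-identityʳ (suc k))) (affine^-* a′ b′ (suc k) (const 1#)))))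
        (affine-* a b (homogenise-polynomial k cs a b a′ b′))

  -- quotient-division states f y - f a ≈ (y - a) * quotient y,
  -- rearranged so that no subtraction occurs.
  record Division (d : ℕ) (f : Carrier → Carrier) (a : Carrier) : Set (c ⊔ ℓ) where
    field
      quotient            : Carrier → Carrier
      quotient-polynomial : IsPolynomial≤ (ℕ.pred d) quotient
      quotient-division   : ∀ y → f y + a * quotient y ≈ f a + y * quotient y

  factor-theorem : ∀ {d f} → IsPolynomial≤ d f → ∀ a → Division d f a
  factor-theorem (const b) a = record
    { quotient = λ _ → 0#
    ; quotient-polynomial = const 0#
    ; quotient-division = λ y → +-congˡ (trans (zeroʳ a) (sym (zeroʳ y)))
    }
  factor-theorem (var* {d} {f} p) a = record
    { quotient = λ y → f y + a * g y
    ; quotient-polynomial = add p (scale a (raise ℕ.pred[n]≤n g-polynomial))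
    ; quotient-division = division
    }
    where
    open Division (factor-theorem p a) renaming (quotient to g; quotient-polynomial to g-polynomial)
    division : ∀ y → y * f y + a * (f y + a * g y) ≈ a * f a + y * (f y + a * g y)
    division y = begin
      y * f y + a * (f y + a * g y)          ≈⟨ +-congˡ (*-congˡ (quotient-division y)) ⟩
      y * f y + a * (f a + y * g y)          ≈⟨ +-congˡ (distribˡ a (f a) (y * g y)) ⟩
      y * f y + (a * f a + a * (y * g y))    ≈⟨ +-leftComm (y * f y) (a * f a) _ ⟩
      a * f a + (y * f y + a * (y * g y))    ≈⟨ +-congˡ (+-congˡ (*-leftComm a y (g y))) ⟩
      a * f a + (y * f y + y * (a * g y))    ≈⟨ +-congˡ (distribˡ y (f y) (a * g y)) ⟨
      a * f a + y * (f y + a * g y)          ∎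
  factor-theorem (add {f = f} {g = h} p q) a = record
    { quotient = λ y → g₁ y + g₂ y
    ; quotient-polynomial = add g₁-polynomial g₂-polynomial
    ; quotient-division = division
    }
    where
    open Division (factor-theorem p a)
      renaming (quotient to g₁; quotient-polynomial to g₁-polynomial; quotient-division to division₁)
    open Division (factor-theorem q a)
      renaming (quotient to g₂; quotient-polynomial to g₂-polynomial; quotient-division to division₂)
    division : ∀ y → (f y + h y) + a * (g₁ y + g₂ y) ≈ (f a + h a) + y * (g₁ y + g₂ y)
    division y = begin
      (f y + h y) + a * (g₁ y + g₂ y)             ≈⟨ +-congˡ (distribˡ a (g₁ y) (g₂ y)) ⟩
      (f y + h y) + (a * g₁ y + a * g₂ y)         ≈⟨ +-interchange (f y) (h y) _ _ ⟩
      (f y + a * g₁ y) + (h y + a * g₂ y)         ≈⟨ +-cong (division₁ y) (division₂ y) ⟩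
      (f a + y * g₁ y) + (h a + y * g₂ y)         ≈⟨ +-interchange (f a) _ (h a) _ ⟩
      (f a + h a) + (y * g₁ y + y * g₂ y)         ≈⟨ +-congˡ (distribˡ y (g₁ y) (g₂ y)) ⟨
      (f a + h a) + y * (g₁ y + g₂ y)             ∎
  factor-theorem (scale {f = f} b p) a = record
    { quotient = λ y → b * g y
    ; quotient-polynomial = scale b g-polynomial
    ; quotient-division = division
    }
    where
    open Division (factor-theorem p a) renaming (quotient to g; quotient-polynomial to g-polynomial)
    division : ∀ y → b * f y + a * (b * g y) ≈ b * f a + y * (b * g y)
    division y = begin
      b * f y + a * (b * g y)      ≈⟨ +-congˡ (*-leftComm a b (g y)) ⟩
      b * f y + b * (a * g y)      ≈⟨ distribˡ b (f y) (a * g y) ⟨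
      b * (f y + a * g y)          ≈⟨ *-congˡ (quotient-division y) ⟩
      b * (f a + y * g y)          ≈⟨ distribˡ b (f a) (y * g y) ⟩
      b * f a + b * (y * g y)      ≈⟨ +-congˡ (*-leftComm b y (g y)) ⟩
      b * f a + y * (b * g y)      ∎
  factor-theorem (raise d≤e p) a = record
    { quotient = quotient
    ; quotient-polynomial = raise (ℕ.pred-mono-≤ d≤e) quotient-polynomial
    ; quotient-division = quotient-division
    }
    where open Division (factor-theorem p a)
  factor-theorem (resp f≈g p) a = record
    { quotient = quotient
    ; quotient-polynomial = quotient-polynomial
    ; quotient-division = λ y →
        trans (+-congʳ (sym (f≈g y))) (trans (quotient-division y) (+-congʳ (f≈g a)))
    }
    where open Division (factor-theorem p a)

  module _ (zero-divisor : ∀ x y → x * y ≈ 0# → x ≈ 0# ⊎ y ≈ 0#) where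

    xz≈yz⇒x≈y⊎z≈0 : ∀ {x y z} → x * z ≈ y * z → x ≈ y ⊎ z ≈ 0#
    xz≈yz⇒x≈y⊎z≈0 {x} {y} {z} xz≈yz = Sum.map₁ (x∙y⁻¹≈ε⇒x≈y x y)
      (zero-divisor (x - y) z (trans ([y-z]x≈yx-zx z x y) (x≈y⇒x∙y⁻¹≈ε xz≈yz)))

    *-cancelʳ-nonzero : ∀ {x y z} → ¬ z ≈ 0# → x * z ≈ y * z → x ≈ y
    *-cancelʳ-nonzero z≉0 = Sum.[ id , ⊥-elim ∘ z≉0 ] ∘ xz≈yz⇒x≈y⊎z≈0

    polynomial-≈0 : ∀ d {f} → IsPolynomial≤ d f →
                    (X : ℕ → Carrier) → (∀ {m n} → X m ≈ X n → m ≡ n) →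
                    ∀ s → (∀ n → s ≤ n → f (X n) ≈ 0#) → ∀ y → f y ≈ 0#
    polynomial-≈0 zero    {f} p X X-injective s f[X]≈0 y =
      trans (degree-0⇒constant p ≡.refl y (X s)) (f[X]≈0 s ℕ.≤-refl)
    polynomial-≈0 (suc d) {f} p X X-injective s f[X]≈0 y = begin
      f y                       ≈⟨ +-identityʳ (f y) ⟨
      f y + 0#                  ≈⟨ +-congˡ (trans (*-congˡ (g≈0 y)) (zeroʳ a)) ⟨
      f y + a * g y             ≈⟨ quotient-division y ⟩
      f a + y * g y             ≈⟨ +-cong f[a]≈0 (trans (*-congˡ (g≈0 y)) (zeroʳ y)) ⟩
      0# + 0#                   ≈⟨ +-identityˡ 0# ⟩
      0#                        ∎
      where
      a = X s
      open Division (factor-theorem p a) renaming (quotient to g)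
      f[a]≈0 : f a ≈ 0#
      f[a]≈0 = f[X]≈0 s ℕ.≤-refl
      g[X]≈0 : ∀ n → suc s ≤ n → g (X n) ≈ 0#
      g[X]≈0 n s<n = Sum.[ (λ a≈Xn → ⊥-elim (ℕ.<⇒≢ s<n (X-injective a≈Xn))) , id ] (xz≈yz⇒x≈y⊎z≈0 (begin
        a * g (X n)               ≈⟨ +-identityˡ _ ⟨
        0# + a * g (X n)          ≈⟨ +-congʳ (f[X]≈0 n (ℕ.<⇒≤ s<n)) ⟨
        f (X n) + a * g (X n)     ≈⟨ quotient-division (X n) ⟩
        f a + X n * g (X n)       ≈⟨ +-congʳ f[a]≈0 ⟩
        0# + X n * g (X n)        ≈⟨ +-identityˡ _ ⟩
        X n * g (X n)             ∎))
      g≈0 : ∀ y → g y ≈ 0#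
      g≈0 = polynomial-≈0 d quotient-polynomial X X-injective (suc s) g[X]≈0

module _ {k : ℕ} {_≼_ : Rel (Fin k) 0ℓ} (_≼?_ : Decidable _≼_) where

  private
    _≽?_ : Decidable (flip _≼_)
    _≽?_ = Flip.decidable _≼_ _≼?_

  head≽ : ∀ {m} → Fin k → Vec (Fin k) m → Bool
  head≽ x []      = true
  head≽ x (y ∷ _) = ⌊ y ≼? x ⌋

  last≼ : ∀ {m} → Vec (Fin k) m → Fin k → Bool
  last≼ []           x = true
  last≼ (y ∷ [])     x = ⌊ y ≼? x ⌋
  last≼ (y ∷ z ∷ zs) x = last≼ (z ∷ zs) x

  weaklyIncr-flip-∷ : ∀ {m} x (xs : Vec (Fin k) m) →
                      weaklyIncr _≽?_ (x ∷ xs) ≡ head≽ x xs ∧ weaklyIncr _≽?_ xs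
  weaklyIncr-flip-∷ x []       = refl
  weaklyIncr-flip-∷ x (y ∷ xs) = refl

  weaklyIncr-∷ʳ : ∀ {m} (ys : Vec (Fin k) m) x →
                  weaklyIncr _≼?_ (ys Vec.∷ʳ x) ≡ weaklyIncr _≼?_ ys ∧ last≼ ys x
  weaklyIncr-∷ʳ []           x = refl
  weaklyIncr-∷ʳ (y ∷ [])     x = Bool.∧-identityʳ _
  weaklyIncr-∷ʳ (y ∷ z ∷ zs) x = ≡.trans (cong (⌊ y ≼? z ⌋ ∧_) (weaklyIncr-∷ʳ (z ∷ zs) x))
    (≡.sym (Bool.∧-assoc ⌊ y ≼? z ⌋ (weaklyIncr _≼?_ (z ∷ zs)) (last≼ (z ∷ zs) x)))

  last≼-∷ʳ : ∀ {m} (ys : Vec (Fin k) m) y x → last≼ (ys Vec.∷ʳ y) x ≡ ⌊ y ≼? x ⌋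
  last≼-∷ʳ []           y x = refl
  last≼-∷ʳ (a ∷ [])     y x = refl
  last≼-∷ʳ (a ∷ b ∷ ys) y x = last≼-∷ʳ (b ∷ ys) y x

  last≼-reverse : ∀ {m} (xs : Vec (Fin k) m) x → last≼ (Vec.reverse xs) x ≡ head≽ x xs
  last≼-reverse []       x = refl
  last≼-reverse (y ∷ xs) x = ≡.trans (cong (λ v → last≼ v x) (Vec.reverse-∷ y xs)) (last≼-∷ʳ (Vec.reverse xs) y x)

  weaklyIncr-flip-reverse : ∀ {m} (xs : Vec (Fin k) m) → weaklyIncr _≽?_ xs ≡ weaklyIncr _≼?_ (Vec.reverse xs)
  weaklyIncr-flip-reverse []       = refl
  weaklyIncr-flip-reverse (x ∷ xs) = begin
    weaklyIncr _≽?_ (x ∷ xs)                  ≡⟨ weaklyIncr-flip-∷ x xs ⟩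
    head≽ x xs ∧ weaklyIncr _≽?_ xs           ≡⟨ cong₂ _∧_ (≡.sym (last≼-reverse xs x)) (weaklyIncr-flip-reverse xs) ⟩
    last≼ rxs x ∧ weaklyIncr _≼?_ rxs         ≡⟨ Bool.∧-comm (last≼ rxs x) (weaklyIncr _≼?_ rxs) ⟩
    weaklyIncr _≼?_ rxs ∧ last≼ rxs x         ≡⟨ weaklyIncr-∷ʳ rxs x ⟨
    weaklyIncr _≼?_ (rxs Vec.∷ʳ x)            ≡⟨ cong (weaklyIncr _≼?_) (Vec.reverse-∷ x xs) ⟨
    weaklyIncr _≼?_ (Vec.reverse (x ∷ xs))    ∎
    where
    open ≡.≡-Reasoning
    rxs = Vec.reverse xs

  vsum-∷ʳ : ∀ f {m} (ys : Vec (Fin k) m) y → vsum _≼?_ f (ys Vec.∷ʳ y) ≡ vsum _≼?_ f ys ℕ.+ f y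
  vsum-∷ʳ f []       y = ℕ.+-comm (f y) 0
  vsum-∷ʳ f (a ∷ ys) y = ≡.trans (cong (f a ℕ.+_) (vsum-∷ʳ f ys y)) (≡.sym (ℕ.+-assoc (f a) _ (f y)))

  vsum-reverse : ∀ f {m} (xs : Vec (Fin k) m) → vsum _≼?_ f (Vec.reverse xs) ≡ vsum _≼?_ f xs
  vsum-reverse f []       = refl
  vsum-reverse f (x ∷ xs) = begin
    vsum _≼?_ f (Vec.reverse (x ∷ xs))     ≡⟨ cong (vsum _≼?_ f) (Vec.reverse-∷ x xs) ⟩
    vsum _≼?_ f (Vec.reverse xs Vec.∷ʳ x)  ≡⟨ vsum-∷ʳ f (Vec.reverse xs) x ⟩
    vsum _≼?_ f (Vec.reverse xs) ℕ.+ f x   ≡⟨ cong (ℕ._+ f x) (vsum-reverse f xs) ⟩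
    vsum _≼?_ f xs ℕ.+ f x                 ≡⟨ ℕ.+-comm (vsum _≼?_ f xs) (f x) ⟩
    f x ℕ.+ vsum _≼?_ f xs                 ∎
    where open ≡.≡-Reasoning

  module _ (h : Fin k → ℕ) (H : ℕ) (h≤H : ∀ x → h x ≤ H) where

    vsum-complement : ∀ {m} (xs : Vec (Fin k) m) →
                      vsum _≼?_ (λ x → H ∸ h x) xs ℕ.+ vsum _≼?_ h xs ≡ m ℕ.* H
    vsum-complement []       = refl
    vsum-complement {suc m} (x ∷ xs) = begin
      (H ∸ h x ℕ.+ S′) ℕ.+ (h x ℕ.+ S)  ≡⟨ interchange (H ∸ h x) S′ (h x) S ⟩
      (H ∸ h x ℕ.+ h x) ℕ.+ (S′ ℕ.+ S)  ≡⟨ cong₂ ℕ._+_ (ℕ.m∸n+n≡m (h≤H x)) (vsum-complement xs) ⟩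
      H ℕ.+ m ℕ.* H                     ∎
      where
      open ≡.≡-Reasoning
      open CommutativeSemigroup ℕ.+-commutativeSemigroup using (interchange)
      S  = vsum _≼?_ h xs
      S′ = vsum _≼?_ (λ x → H ∸ h x) xs

private
  module ℤ[q]-Lemmas = CommutativeRingLemmas ℤ[q]
  module *ₚ = CommutativeSemigroup (CommutativeRing.*-commutativeSemigroup ℤ[q])

*ₚ-cancelʳ : ∀ {p r s} → ¬ s ≋ [] → p *ₚ s ≋ r *ₚ s → p ≋ r
*ₚ-cancelʳ = ℤ[q]-Lemmas.*-cancelʳ-nonzero *ₚ-zero-divisor

*ₚ-nonzero : ∀ {p r} → ¬ p ≋ [] → ¬ r ≋ [] → ¬ p *ₚ r ≋ []
*ₚ-nonzero p≉0 r≉0 pr≈0 = Sum.[ p≉0 , r≉0 ] (*ₚ-zero-divisor _ _ pr≈0)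

-- Identities in ℤ[q] to which the laws of fractions reduce after
-- cross-multiplication.
private
  module Cross where
    open AlmostCommutativeRing ℤ[q]-ACR using (_+_; _*_; -_; 0#; 1#)

    +-cong₁ : ∀ a b c d b′ d′ → (a * d + c * b) * (b′ * d′) ≋ (a * b′) * (d * d′) + (c * d′) * (b * b′)
    +-cong₁ = solve-∀ ℤ[q]-ACR
    +-cong₂ : ∀ a′ b c′ d b′ d′ → (a′ * b) * (d * d′) + (c′ * d) * (b * b′) ≋ (a′ * d′ + c′ * b′) * (b * d)
    +-cong₂ = solve-∀ ℤ[q]-ACR
    -‿cong : ∀ a b → (- a) * b ≋ - (a * b)
    -‿cong = solve-∀ ℤ[q]-ACR
    +-assoc : ∀ a b c d e f → ((a * d + c * b) * f + e * (b * d)) * (b * (d * f))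
                            ≋ (a * (d * f) + (c * f + e * d) * b) * ((b * d) * f)
    +-assoc = solve-∀ ℤ[q]-ACR
    +-comm : ∀ a b c d → (a * d + c * b) * (d * b) ≋ (c * b + a * d) * (b * d)
    +-comm = solve-∀ ℤ[q]-ACR
    +-identityˡ : ∀ a b → (0# * b + a * 1#) * b ≋ a * (1# * b)
    +-identityˡ = solve-∀ ℤ[q]-ACR
    -‿inverseˡ : ∀ a b → ((- a) * b + a * b) * 1# ≋ 0# * (b * b)
    -‿inverseˡ = solve-∀ ℤ[q]-ACR
    *-assoc : ∀ a b c d e f → ((a * c) * e) * (b * (d * f)) ≋ (a * (c * e)) * ((b * d) * f)
    *-assoc = solve-∀ ℤ[q]-ACR
    *-comm : ∀ a b c d → (a * c) * (d * b) ≋ (c * a) * (b * d)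
    *-comm = solve-∀ ℤ[q]-ACR
    *-identityˡ : ∀ a b → (1# * a) * b ≋ a * (1# * b)
    *-identityˡ = solve-∀ ℤ[q]-ACR
    distribˡ : ∀ a b c d e f → (a * (c * f + e * d)) * ((b * d) * (b * f))
                             ≋ ((a * c) * (b * f) + (a * e) * (b * d)) * (b * (d * f))
    distribˡ = solve-∀ ℤ[q]-ACR
    *-inverseʳ : ∀ a b → (a * b) * 1# ≋ 1# * (b * a)
    *-inverseʳ = solve-∀ ℤ[q]-ACR
    ι-+ : ∀ p r → (p + r) * (1# * 1#) ≋ (p * 1# + r * 1#) * 1#
    ι-+ = solve-∀ ℤ[q]-ACR
    ι-* : ∀ p r → (p * r) * (1# * 1#) ≋ (p * r) * 1#
    ι-* = solve-∀ ℤ[q]-ACR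
    q-integer : ∀ a b c → (((a * 1# + - (1# * b)) * 1#) * c) * (b * 1#) ≋ (a * 1# + (- 1#) * b) * (((b * 1#) * c) * 1#)
    q-integer = solve-∀ ℤ[q]-ACR
    *-ι-den : ∀ a b → (a * b) * 1# ≋ a * (b * 1#)
    *-ι-den = solve-∀ ℤ[q]-ACR

-- The field ℚ(q).  The proof field is irrelevant, so that fractions with
-- the same value are definitionally equal.
record Frac : Set where
  constructor frac
  field
    val     : RatFun
    .den≄0′ : ¬ den val ≋ []
open Frac using (val)

den≄0 : ∀ x → ¬ den (val x) ≋ []
den≄0 (frac _ den≄0′) = ¬-recompute den≄0′

fromWF : ∀ x → WF x → Frac
fromWF x wf = frac x (λ e → wf (coeff-≡ e))

infix 4 _≃_
record _≃_ (x y : Frac) : Set where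
  constructor mk≃
  field cross : num (val x) *ₚ den (val y) ≋ num (val y) *ₚ den (val x)
open _≃_

infixl 6 _+_ _-_
infixl 7 _*_
infix  8 -_

_+_ : Frac → Frac → Frac
x + y = frac (val x +r val y) (*ₚ-nonzero (den≄0 x) (den≄0 y))

_*_ : Frac → Frac → Frac
x * y = frac (val x *r val y) (*ₚ-nonzero (den≄0 x) (den≄0 y))

-_ : Frac → Frac
- x = frac ((-ₚ num (val x)) / den (val x)) (den≄0 x)

_-_ : Frac → Frac → Frac
x - y = x + - y

ι : Poly → Frac
ι p = frac (fromPoly p) (mono-nonzero 0)

0# 1# : Frac
0# = ι []
1# = ι (mono 0)

private
  numᶠ denᶠ : Frac → Poly
  numᶠ x = num (val x)
  denᶠ x = den (val x)

≃-isEquivalence : IsEquivalence _≃_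
≃-isEquivalence = record
  { refl  = mk≃ ≋-refl
  ; sym   = λ x≃y → mk≃ (≋-sym (cross x≃y))
  ; trans = trans
  }
  where
  trans : ∀ {x y z} → x ≃ y → y ≃ z → x ≃ z
  trans {x} {y} {z} (mk≃ xy) (mk≃ yz) = mk≃ (*ₚ-cancelʳ (den≄0 y) (begin
    (numᶠ x *ₚ denᶠ z) *ₚ denᶠ y  ≈⟨ *ₚ.xy∙z≈xz∙y (numᶠ x) (denᶠ z) (denᶠ y) ⟩
    (numᶠ x *ₚ denᶠ y) *ₚ denᶠ z  ≈⟨ *ₚ-congˡ (denᶠ z) xy ⟩
    (numᶠ y *ₚ denᶠ x) *ₚ denᶠ z  ≈⟨ *ₚ.xy∙z≈xz∙y (numᶠ y) (denᶠ x) (denᶠ z) ⟩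
    (numᶠ y *ₚ denᶠ z) *ₚ denᶠ x  ≈⟨ *ₚ-congˡ (denᶠ x) yz ⟩
    (numᶠ z *ₚ denᶠ y) *ₚ denᶠ x  ≈⟨ *ₚ.xy∙z≈xz∙y (numᶠ z) (denᶠ y) (denᶠ x) ⟩
    (numᶠ z *ₚ denᶠ x) *ₚ denᶠ y  ∎))
    where open ≋-Reasoning

+-cong : ∀ {x x′ y y′} → x ≃ x′ → y ≃ y′ → x + y ≃ x′ + y′
+-cong {x} {x′} {y} {y′} (mk≃ xx′) (mk≃ yy′) = mk≃ (begin
  ((numᶠ x *ₚ denᶠ y) +ₚ (numᶠ y *ₚ denᶠ x)) *ₚ (denᶠ x′ *ₚ denᶠ y′)
    ≈⟨ Cross.+-cong₁ (numᶠ x) (denᶠ x) (numᶠ y) (denᶠ y) (denᶠ x′) (denᶠ y′) ⟩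
  ((numᶠ x *ₚ denᶠ x′) *ₚ (denᶠ y *ₚ denᶠ y′)) +ₚ ((numᶠ y *ₚ denᶠ y′) *ₚ (denᶠ x *ₚ denᶠ x′))
    ≈⟨ +ₚ-cong (*ₚ-congˡ _ xx′) (*ₚ-congˡ _ yy′) ⟩
  ((numᶠ x′ *ₚ denᶠ x) *ₚ (denᶠ y *ₚ denᶠ y′)) +ₚ ((numᶠ y′ *ₚ denᶠ y) *ₚ (denᶠ x *ₚ denᶠ x′))
    ≈⟨ Cross.+-cong₂ (numᶠ x′) (denᶠ x) (numᶠ y′) (denᶠ y) (denᶠ x′) (denᶠ y′) ⟩
  ((numᶠ x′ *ₚ denᶠ y′) +ₚ (numᶠ y′ *ₚ denᶠ x′)) *ₚ (denᶠ x *ₚ denᶠ y) ∎)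
  where open ≋-Reasoning

*-cong : ∀ {x x′ y y′} → x ≃ x′ → y ≃ y′ → x * y ≃ x′ * y′
*-cong {x} {x′} {y} {y′} (mk≃ xx′) (mk≃ yy′) = mk≃ (begin
  (numᶠ x *ₚ numᶠ y) *ₚ (denᶠ x′ *ₚ denᶠ y′)  ≈⟨ *ₚ.interchange (numᶠ x) (numᶠ y) (denᶠ x′) (denᶠ y′) ⟩
  (numᶠ x *ₚ denᶠ x′) *ₚ (numᶠ y *ₚ denᶠ y′)  ≈⟨ *ₚ-congˡ _ xx′ ⟩
  (numᶠ x′ *ₚ denᶠ x) *ₚ (numᶠ y *ₚ denᶠ y′)  ≈⟨ *ₚ-congʳ (numᶠ x′ *ₚ denᶠ x) yy′ ⟩
  (numᶠ x′ *ₚ denᶠ x) *ₚ (numᶠ y′ *ₚ denᶠ y)  ≈⟨ *ₚ.interchange (numᶠ x′) (denᶠ x) (numᶠ y′) (denᶠ y) ⟩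
  (numᶠ x′ *ₚ numᶠ y′) *ₚ (denᶠ x *ₚ denᶠ y)  ∎)
  where open ≋-Reasoning

-‿cong : ∀ {x x′} → x ≃ x′ → - x ≃ - x′
-‿cong {x} {x′} (mk≃ xx′) = mk≃ (≋-trans (Cross.-‿cong (numᶠ x) (denᶠ x′))
  (≋-trans (-ₚ-cong xx′) (≋-sym (Cross.-‿cong (numᶠ x′) (denᶠ x)))))

Frac-ring : CommutativeRing 0ℓ 0ℓ
Frac-ring = record
  { Carrier = Frac ; _≈_ = _≃_ ; _+_ = _+_ ; _*_ = _*_ ; -_ = -_ ; 0# = 0# ; 1# = 1#
  ; isCommutativeRing = record
    { isRing = record
      { +-isAbelianGroup = record
        { isGroup = record
          { isMonoid = record
            { isSemigroup = record
              { isMagma = record { isEquivalence = ≃-isEquivalence ; ∙-cong = +-cong }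
              ; assoc = λ x y z → mk≃ (Cross.+-assoc (numᶠ x) (denᶠ x) (numᶠ y) (denᶠ y) (numᶠ z) (denᶠ z)) }
            ; identity = +-identityˡ , λ x → trans (+-comm x 0#) (+-identityˡ x) }
          ; inverse = -‿inverseˡ , λ x → trans (+-comm x (- x)) (-‿inverseˡ x)
          ; ⁻¹-cong = -‿cong }
        ; comm = +-comm }
      ; *-cong = *-cong
      ; *-assoc = λ x y z → mk≃ (Cross.*-assoc (numᶠ x) (denᶠ x) (numᶠ y) (denᶠ y) (numᶠ z) (denᶠ z))
      ; *-identity = *-identityˡ , λ x → trans (*-comm x 1#) (*-identityˡ x)
      ; distrib = distribˡ , λ x y z → trans (*-comm (y + z) x)
                                        (trans (distribˡ x y z) (+-cong (*-comm x y) (*-comm x z))) }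
    ; *-comm = *-comm } }
  where
  open IsEquivalence ≃-isEquivalence using (trans)
  +-comm : ∀ x y → x + y ≃ y + x
  +-comm x y = mk≃ (Cross.+-comm (numᶠ x) (denᶠ x) (numᶠ y) (denᶠ y))
  +-identityˡ : ∀ x → 0# + x ≃ x
  +-identityˡ x = mk≃ (Cross.+-identityˡ (numᶠ x) (denᶠ x))
  -‿inverseˡ : ∀ x → - x + x ≃ 0#
  -‿inverseˡ x = mk≃ (Cross.-‿inverseˡ (numᶠ x) (denᶠ x))
  *-comm : ∀ x y → x * y ≃ y * x
  *-comm x y = mk≃ (Cross.*-comm (numᶠ x) (denᶠ x) (numᶠ y) (denᶠ y))
  *-identityˡ : ∀ x → 1# * x ≃ x
  *-identityˡ x = mk≃ (Cross.*-identityˡ (numᶠ x) (denᶠ x))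
  distribˡ : ∀ x y z → x * (y + z) ≃ x * y + x * z
  distribˡ x y z = mk≃ (Cross.distribˡ (numᶠ x) (denᶠ x) (numᶠ y) (denᶠ y) (numᶠ z) (denᶠ z))

num≋0⇒≃0 : ∀ {x} → num (val x) ≋ [] → x ≃ 0#
num≋0⇒≃0 {x} e = mk≃ (*ₚ-zeroˡ (mono 0) e)

≃0⇒num≋0 : ∀ {x} → x ≃ 0# → num (val x) ≋ []
≃0⇒num≋0 {x} (mk≃ e) = ≋-trans (≋-sym (CommutativeRing.*-identityʳ ℤ[q] (num (val x)))) e

Frac-ACR : AlmostCommutativeRing 0ℓ 0ℓ
Frac-ACR = fromCommutativeRing Frac-ring λ x →
  Maybe.map (λ e → IsEquivalence.sym ≃-isEquivalence (num≋0⇒≃0 e)) (dec⇒maybe (≋[]? (num (val x))))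

_≄0 : Frac → Set
x ≄0 = ¬ x ≃ 0#

*-zero-divisor : ∀ x y → x * y ≃ 0# → x ≃ 0# ⊎ y ≃ 0#
*-zero-divisor x y xy≃0 =
  Sum.map num≋0⇒≃0 num≋0⇒≃0 (*ₚ-zero-divisor (num (val x)) (num (val y)) (≃0⇒num≋0 xy≃0))

*-nonzero : ∀ {x y} → x ≄0 → y ≄0 → (x * y) ≄0
*-nonzero {x} {y} x≄0 y≄0 xy≃0 = Sum.[ x≄0 , y≄0 ] (*-zero-divisor x y xy≃0)

infix 9 _⁻¹⟨_⟩
_⁻¹⟨_⟩ : (x : Frac) → .(x ≄0) → Frac
x ⁻¹⟨ x≄0 ⟩ = frac (den (val x) / num (val x)) (λ e → x≄0 (num≋0⇒≃0 e))

*-inverseʳ : ∀ x .(x≄0 : x ≄0) → x * x ⁻¹⟨ x≄0 ⟩ ≃ 1#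
*-inverseʳ x x≄0 = mk≃ (Cross.*-inverseʳ (num (val x)) (den (val x)))

ι-cong : ∀ {p r} → p ≋ r → ι p ≃ ι r
ι-cong p≋r = mk≃ (*ₚ-congˡ (mono 0) p≋r)

ι-+ : ∀ p r → ι (p +ₚ r) ≃ ι p + ι r
ι-+ p r = mk≃ (Cross.ι-+ p r)

ι-* : ∀ p r → ι (p *ₚ r) ≃ ι p * ι r
ι-* p r = mk≃ (Cross.ι-* p r)

*-ι-den : ∀ x → x * ι (den (val x)) ≃ ι (num (val x))
*-ι-den x = mk≃ (Cross.*-ι-den (num (val x)) (den (val x)))

ι-nonzero : ∀ {p} → ¬ p ≋ [] → ι p ≄0
ι-nonzero {p} p≉0 = p≉0 ∘ ≃0⇒num≋0 {ι p}

-- Powers of q and q-integers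

open CommutativeRing Frac-ring
  using (setoid; +-congˡ; +-congʳ; *-congˡ; *-congʳ;
         +-assoc; +-comm; +-identityˡ; +-identityʳ; *-assoc; *-comm; *-identityˡ; *-identityʳ;
         distribˡ; distribʳ; zeroˡ; zeroʳ; -‿inverseˡ; -‿inverseʳ; +-group; rawRing)
  renaming (refl to ≃-refl; sym to ≃-sym; trans to ≃-trans; reflexive to ≃-reflexive)
open CommutativeRingLemmas Frac-ring
module ≃-Reasoning = SetoidReasoning setoid
open ≃-Reasoning

q : Frac
q = ι (mono 1)

q≄0 : q ≄0
q≄0 = ι-nonzero (mono-nonzero 1)

q⁻¹ : Frac
q⁻¹ = q ⁻¹⟨ q≄0 ⟩

open UnitPowers q q⁻¹ (*-inverseʳ q q≄0)
  using (pow; pow-+; pow-*ℕ; u^m*v^m≈1)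

mono-suc : ∀ m → mono (suc m) ≋ mono 1 *ₚ mono m
mono-suc m = ≋-sym (mono1-*ₚ (mono m))

ι-mono : ∀ m → ι (mono m) ≃ q ^ m
ι-mono zero    = ≃-refl
ι-mono (suc m) = begin
  ι (mono (suc m))      ≈⟨ ι-cong (mono-suc m) ⟩
  ι (mono 1 *ₚ mono m)  ≈⟨ ι-* (mono 1) (mono m) ⟩
  q * ι (mono m)        ≈⟨ *-congˡ {q} (ι-mono m) ⟩
  q * q ^ m             ∎

qpow-den≄0 : ∀ n → ¬ den (qpow n) ≋ []
qpow-den≄0 (+ m)    = mono-nonzero 0
qpow-den≄0 -[1+ m ] = mono-nonzero (suc m)

qPow : ℤ → Frac
qPow n = frac (qpow n) (qpow-den≄0 n)

qPow≃pow : ∀ n → qPow n ≃ pow n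
qPow≃pow (+ m)    = ι-mono m
qPow≃pow -[1+ m ] = inverse-unique {x = q ^ suc m}
  (≃-trans (*-congʳ {qPow -[1+ m ]} (≃-sym (ι-mono (suc m))))
           (*-inverseʳ (ι (mono (suc m))) (ι-nonzero (mono-nonzero (suc m)))))
  (u^m*v^m≈1 (suc m))

q-1ₚ : Poly
q-1ₚ = -[1+ 0 ] ∷ + 1 ∷ []

ι[q-1ₚ]≃q-1 : ι q-1ₚ ≃ q - 1#
ι[q-1ₚ]≃q-1 = mk≃ (mk≋ λ { 0 → refl ; 1 → refl ; (suc (suc i)) → refl })

q-1ₚ≉0 : ¬ q-1ₚ ≋ []
q-1ₚ≉0 e with coeff-≡ e 0
... | ()

q-1≄0 : (q - 1#) ≄0
q-1≄0 e = ι-nonzero q-1ₚ≉0 (≃-trans ι[q-1ₚ]≃q-1 e)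

qInt : ℤ → Frac
qInt n = frac (qint n) (*ₚ-nonzero (*ₚ-nonzero (qpow-den≄0 n) (mono-nonzero 0)) q-1ₚ≉0)

qInt-*-q-1 : ∀ n → qInt n * (q - 1#) ≃ pow n - 1#
qInt-*-q-1 n = begin
  qInt n * (q - 1#)  ≈⟨ *-congˡ {qInt n} (≃-sym ι[q-1ₚ]≃q-1) ⟩
  qInt n * ι q-1ₚ    ≈⟨ mk≃ (Cross.q-integer (num (qpow n)) (den (qpow n)) q-1ₚ) ⟩
  qPow n - 1#        ≈⟨ +-congʳ { - 1#} (qPow≃pow n) ⟩
  pow n - 1#         ∎

ι-injective : ∀ {p r} → ι p ≃ ι r → p ≋ r
ι-injective {p} {r} (mk≃ e) =
  ≋-trans (≋-sym (*ₚ-identityʳ p)) (≋-trans e (*ₚ-identityʳ r))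
  where open CommutativeRing ℤ[q] using () renaming (*-identityʳ to *ₚ-identityʳ)

qInt-injective : ∀ {m n} → qInt (+ m) ≃ qInt (+ n) → m ≡ n
qInt-injective {m} {n} e = mono-injective (ι-injective (begin
  ι (mono m)            ≈⟨ ι-mono m ⟩
  q ^ m                 ≈⟨ ∙-cancelʳ (- 1#) (q ^ m) (q ^ n) (begin
    q ^ m - 1#               ≈⟨ qInt-*-q-1 (+ m) ⟨
    qInt (+ m) * (q - 1#)    ≈⟨ *-congʳ {q - 1#} e ⟩
    qInt (+ n) * (q - 1#)    ≈⟨ qInt-*-q-1 (+ n) ⟩
    q ^ n - 1#               ∎) ⟩
  q ^ n                 ≈⟨ ι-mono n ⟨
  ι (mono n)            ∎))
  where open import Algebra.Properties.Group +-group using (∙-cancelʳ)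

C : ℤ → Frac
C a = ι (a ∷ [])

C-+ : ∀ a b → C (a ℤ.+ b) ≃ C a + C b
C-+ a b = ι-+ (a ∷ []) (b ∷ [])

C-* : ∀ a b → C (a ℤ.* b) ≃ C a * C b
C-* a b = ≃-trans (ι-cong (∷-cong (≡.sym (ℤ.+-identityʳ (a ℤ.* b))) ≋-refl)) (ι-* (a ∷ []) (b ∷ []))

C-0 : C (+ 0) ≃ 0#
C-0 = num≋0⇒≃0 (∷-≋-[]⁺ refl ≋-refl)

ι-∷ : ∀ a p → ι (a ∷ p) ≃ C a + q * ι p
ι-∷ a p = begin
  ι (a ∷ p)                      ≈⟨ ι-cong (≋-sym a∷p≋) ⟩
  ι ((a ∷ []) +ₚ (mono 1 *ₚ p))  ≈⟨ ι-+ (a ∷ []) (mono 1 *ₚ p) ⟩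
  C a + ι (mono 1 *ₚ p)          ≈⟨ +-congˡ {C a} (ι-* (mono 1) p) ⟩
  C a + q * ι p                  ∎
  where
  a∷p≋ : (a ∷ []) +ₚ (mono 1 *ₚ p) ≋ a ∷ p
  a∷p≋ = ≋-trans (+ₚ-cong {a ∷ []} ≋-refl (mono1-*ₚ p)) (∷-cong (ℤ.+-identityʳ a) ≋-refl)


evalAt : Frac → Poly → Frac
evalAt t []      = 0#
evalAt t (a ∷ p) = C a + t * evalAt t p

module _ (t : Frac) where

  evalAt-≋[] : ∀ {p} → p ≋ [] → evalAt t p ≃ 0#
  evalAt-≋[] {[]}    p≋0 = ≃-refl
  evalAt-≋[] {a ∷ p} p≋0 =
    let a≡0 , p≋0 = ∷-≋-[] p≋0 in begin
    C a + t * evalAt t p  ≈⟨ +-cong (≃-trans (≃-reflexive (≡.cong C a≡0)) C-0) (*-congˡ {t} (evalAt-≋[] p≋0)) ⟩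
    0# + t * 0#           ≈⟨ 0+t*0≃0 t ⟩
    0#                    ∎
    where
    0+t*0≃0 : ∀ t → 0# + t * 0# ≃ 0#
    0+t*0≃0 = solve-∀ Frac-ACR

  evalAt-cong : ∀ {p r} → p ≋ r → evalAt t p ≃ evalAt t r
  evalAt-cong {[]}    {r}     p≋r = ≃-sym (evalAt-≋[] (≋-sym p≋r))
  evalAt-cong {a ∷ p} {[]}    p≋r = evalAt-≋[] p≋r
  evalAt-cong {a ∷ p} {b ∷ r} p≋r =
    +-cong (≃-reflexive (≡.cong C (coeff-≡ p≋r 0))) (*-congˡ {t} (evalAt-cong (∷-≋-tail p≋r)))

  evalAt-+ : ∀ p r → evalAt t (p +ₚ r) ≃ evalAt t p + evalAt t r
  evalAt-+ []      r       = ≃-sym (+-identityˡ _)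
  evalAt-+ (a ∷ p) []      = ≃-sym (+-identityʳ _)
  evalAt-+ (a ∷ p) (b ∷ r) = begin
    C (a ℤ.+ b) + t * evalAt t (p +ₚ r)              ≈⟨ +-cong (C-+ a b) (*-congˡ {t} (evalAt-+ p r)) ⟩
    (C a + C b) + t * (evalAt t p + evalAt t r)      ≈⟨ regroup (C a) (C b) t (evalAt t p) (evalAt t r) ⟩
    (C a + t * evalAt t p) + (C b + t * evalAt t r)  ∎
    where
    regroup : ∀ a b t x y → (a + b) + t * (x + y) ≃ (a + t * x) + (b + t * y)
    regroup = solve-∀ Frac-ACR

  evalAt-· : ∀ a p → evalAt t (a ·ₚ p) ≃ C a * evalAt t p
  evalAt-· a []      = ≃-sym (zeroʳ (C a))
  evalAt-· a (b ∷ p) = begin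
    C (a ℤ.* b) + t * evalAt t (a ·ₚ p)  ≈⟨ +-cong (C-* a b) (*-congˡ {t} (evalAt-· a p)) ⟩
    C a * C b + t * (C a * evalAt t p)   ≈⟨ regroup (C a) (C b) t (evalAt t p) ⟩
    C a * (C b + t * evalAt t p)         ∎
    where
    regroup : ∀ a b t x → a * b + t * (a * x) ≃ a * (b + t * x)
    regroup = solve-∀ Frac-ACR

  evalAt-* : ∀ p r → evalAt t (p *ₚ r) ≃ evalAt t p * evalAt t r
  evalAt-* []      r = ≃-sym (zeroˡ (evalAt t r))
  evalAt-* (a ∷ p) r = begin
    evalAt t ((a ·ₚ r) +ₚ (+ 0 ∷ (p *ₚ r)))                ≈⟨ evalAt-+ (a ·ₚ r) (+ 0 ∷ (p *ₚ r)) ⟩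
    evalAt t (a ·ₚ r) + (C (+ 0) + t * evalAt t (p *ₚ r))  ≈⟨ +-cong (evalAt-· a r) (+-cong C-0 (*-congˡ {t} (evalAt-* p r))) ⟩
    C a * R + (0# + t * (evalAt t p * R))                  ≈⟨ regroup (C a) R t (evalAt t p) ⟩
    (C a + t * evalAt t p) * R                             ∎
    where
    R = evalAt t r
    regroup : ∀ a r t x → a * r + (0# + t * (x * r)) ≃ (a + t * x) * r
    regroup = solve-∀ Frac-ACR

  evalAt-mono : ∀ m → evalAt t (mono m) ≃ t ^ m
  evalAt-mono zero    = ≃-trans (+-congˡ {C (+ 1)} (zeroʳ t)) (+-identityʳ _)
  evalAt-mono (suc m) = begin
    C (+ 0) + t * evalAt t (mono m)  ≈⟨ +-cong C-0 (*-congˡ {t} (evalAt-mono m)) ⟩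
    0# + t * t ^ m                   ≈⟨ +-identityˡ _ ⟩
    t * t ^ m                        ∎

ι≃evalAt-q : ∀ p → ι p ≃ evalAt q p
ι≃evalAt-q []      = ≃-refl
ι≃evalAt-q (a ∷ p) = ≃-trans (ι-∷ a p) (+-congˡ {C a} (*-congˡ {q} (ι≃evalAt-q p)))

-- The substitution q ↦ q⁻¹

σ : Poly → Frac
σ = evalAt q⁻¹

ι-∷ʳ : ∀ p c → ι (p ∷ʳ c) ≃ ι p + C c * q ^ length p
ι-∷ʳ []      c = ≃-sym (≃-trans (+-identityˡ _) (*-identityʳ (C c)))
ι-∷ʳ (a ∷ p) c = begin
  ι (a ∷ (p ∷ʳ c))                            ≈⟨ ι-∷ a (p ∷ʳ c) ⟩
  C a + q * ι (p ∷ʳ c)                        ≈⟨ +-congˡ {C a} (*-congˡ {q} (ι-∷ʳ p c)) ⟩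
  C a + q * (ι p + C c * q ^ length p)        ≈⟨ regroup (C a) q (ι p) (C c) (q ^ length p) ⟩
  (C a + q * ι p) + C c * (q * q ^ length p)  ≈⟨ +-congʳ {C c * (q * q ^ length p)} (ι-∷ a p) ⟨
  ι (a ∷ p) + C c * q ^ length (a ∷ p)        ∎
  where
  regroup : ∀ a q x c y → a + q * (x + c * y) ≃ (a + q * x) + c * (q * y)
  regroup = solve-∀ Frac-ACR

ι-reverse : ∀ p → ι (reverse p) * q ≃ q ^ length p * σ p
ι-reverse []      = ≃-trans (zeroˡ q) (≃-sym (zeroʳ 1#))
ι-reverse (a ∷ p) = begin
  ι (reverse (a ∷ p)) * q                     ≡⟨ ≡.cong (λ r → ι r * q) (List.unfold-reverse a p) ⟩
  ι (reverse p ∷ʳ a) * q                      ≈⟨ *-congʳ {q} (ι-∷ʳ (reverse p) a) ⟩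
  (ι (reverse p) + C a * q ^ length (reverse p)) * q
                                              ≡⟨ ≡.cong (λ l → (ι (reverse p) + C a * q ^ l) * q) (List.length-reverse p) ⟩
  (ι (reverse p) + C a * qˡ) * q              ≈⟨ distribʳ q (ι (reverse p)) (C a * qˡ) ⟩
  ι (reverse p) * q + C a * qˡ * q            ≈⟨ +-congʳ {C a * qˡ * q} (ι-reverse p) ⟩
  qˡ * σ p + C a * qˡ * q                     ≈⟨ +-congʳ {C a * qˡ * q} (*-identityˡ (qˡ * σ p)) ⟨
  1# * (qˡ * σ p) + C a * qˡ * q              ≈⟨ +-congʳ {C a * qˡ * q} (*-congʳ {qˡ * σ p} (*-inverseʳ q q≄0)) ⟨
  (q * q⁻¹) * (qˡ * σ p) + C a * qˡ * q       ≈⟨ regroup q q⁻¹ qˡ (σ p) (C a) ⟩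
  (q * qˡ) * (C a + q⁻¹ * σ p)                ∎
  where
  qˡ = q ^ length p
  regroup : ∀ q q⁻¹ qˡ s c → (q * q⁻¹) * (qˡ * s) + c * qˡ * q ≃ (q * qˡ) * (c + q⁻¹ * s)
  regroup = solve-∀ Frac-ACR

σ-nonzero : ∀ {p} → ¬ p ≋ [] → σ p ≄0
σ-nonzero {p} p≉0 σp≃0 = p≉0 (reverse-≋-[] p (≃0⇒num≋0 {ι (reverse p)} ι[rev-p]≃0))
  where
  ι[rev-p]*q≃0 : ι (reverse p) * q ≃ 0#
  ι[rev-p]*q≃0 = begin
    ι (reverse p) * q   ≈⟨ ι-reverse p ⟩
    q ^ length p * σ p  ≈⟨ *-congˡ {q ^ length p} σp≃0 ⟩
    q ^ length p * 0#   ≈⟨ zeroʳ (q ^ length p) ⟩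
    0#                  ∎
  ι[rev-p]≃0 : ι (reverse p) ≃ 0#
  ι[rev-p]≃0 = Sum.[ id , ⊥-elim ∘ q≄0 ] (*-zero-divisor (ι (reverse p)) q ι[rev-p]*q≃0)

σᶠ : Frac → Frac
σᶠ x = σ (num (val x)) * σ (den (val x)) ⁻¹⟨ σ-nonzero (den≄0 x) ⟩

σᶠ-spec : ∀ x → σᶠ x * σ (den (val x)) ≃ σ (num (val x))
σᶠ-spec x = begin
  (σ a * σb⁻¹) * σ b  ≈⟨ *-assoc (σ a) σb⁻¹ (σ b) ⟩
  σ a * (σb⁻¹ * σ b)  ≈⟨ *-congˡ {σ a} (*-comm σb⁻¹ (σ b)) ⟩
  σ a * (σ b * σb⁻¹)  ≈⟨ *-congˡ {σ a} (*-inverseʳ (σ b) (σ-nonzero (den≄0 x))) ⟩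
  σ a * 1#            ≈⟨ *-identityʳ (σ a) ⟩
  σ a                 ∎
  where
  a = num (val x)
  b = den (val x)
  σb⁻¹ = σ b ⁻¹⟨ σ-nonzero (den≄0 x) ⟩

σᶠ-unique : ∀ {x y} → y * σ (den (val x)) ≃ σ (num (val x)) → y ≃ σᶠ x
σᶠ-unique {x} e = *-cancelʳ-nonzero *-zero-divisor (σ-nonzero (den≄0 x)) (≃-trans e (≃-sym (σᶠ-spec x)))

private
  open CommutativeSemigroup (CommutativeRing.*-commutativeSemigroup Frac-ring)
    using (xy∙z≈xz∙y; interchange)

  σ-* : ∀ p r → σ (p *ₚ r) ≃ σ p * σ r
  σ-* = evalAt-* q⁻¹

  σ-+ : ∀ p r → σ (p +ₚ r) ≃ σ p + σ r
  σ-+ = evalAt-+ q⁻¹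

σᶠ-cong : ∀ {x y} → x ≃ y → σᶠ x ≃ σᶠ y
σᶠ-cong {x} {y} (mk≃ e) = σᶠ-unique {y} (*-cancelʳ-nonzero *-zero-divisor (σ-nonzero (den≄0 x)) (begin
  (σᶠ x * σ d′) * σ d    ≈⟨ xy∙z≈xz∙y (σᶠ x) (σ d′) (σ d) ⟩
  (σᶠ x * σ d) * σ d′    ≈⟨ *-congʳ {σ d′} (σᶠ-spec x) ⟩
  σ n * σ d′            ≈⟨ σ-* n d′ ⟨
  σ (n *ₚ d′)           ≈⟨ evalAt-cong q⁻¹ e ⟩
  σ (n′ *ₚ d)           ≈⟨ σ-* n′ d ⟩
  σ n′ * σ d            ∎))
  where
  n = num (val x)
  d = den (val x)
  n′ = num (val y)
  d′ = den (val y)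

module _ (x y : Frac) where
  private
    a = num (val x)
    b = den (val x)
    c = num (val y)
    d = den (val y)

  σᶠ-+ : σᶠ (x + y) ≃ σᶠ x + σᶠ y
  σᶠ-+ = ≃-sym (σᶠ-unique {x + y} (begin
    (σᶠ x + σᶠ y) * σ (b *ₚ d)                  ≈⟨ *-congˡ {σᶠ x + σᶠ y} (σ-* b d) ⟩
    (σᶠ x + σᶠ y) * (σ b * σ d)                 ≈⟨ regroup (σᶠ x) (σᶠ y) (σ b) (σ d) ⟩
    (σᶠ x * σ b) * σ d + (σᶠ y * σ d) * σ b     ≈⟨ +-cong (*-congʳ {σ d} (σᶠ-spec x)) (*-congʳ {σ b} (σᶠ-spec y)) ⟩
    σ a * σ d + σ c * σ b                     ≈⟨ +-cong (σ-* a d) (σ-* c b) ⟨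
    σ (a *ₚ d) + σ (c *ₚ b)                   ≈⟨ σ-+ (a *ₚ d) (c *ₚ b) ⟨
    σ ((a *ₚ d) +ₚ (c *ₚ b))                  ∎))
    where
    regroup : ∀ X Y B D → (X + Y) * (B * D) ≃ (X * B) * D + (Y * D) * B
    regroup = solve-∀ Frac-ACR

  σᶠ-* : σᶠ (x * y) ≃ σᶠ x * σᶠ y
  σᶠ-* = ≃-sym (σᶠ-unique {x * y} (begin
    (σᶠ x * σᶠ y) * σ (b *ₚ d)       ≈⟨ *-congˡ {σᶠ x * σᶠ y} (σ-* b d) ⟩
    (σᶠ x * σᶠ y) * (σ b * σ d)      ≈⟨ interchange (σᶠ x) (σᶠ y) (σ b) (σ d) ⟩
    (σᶠ x * σ b) * (σᶠ y * σ d)      ≈⟨ *-cong (σᶠ-spec x) (σᶠ-spec y) ⟩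
    σ a * σ c                      ≈⟨ σ-* a c ⟨
    σ (a *ₚ c)                     ∎))

σᶠ-ι : ∀ p → σᶠ (ι p) ≃ σ p
σᶠ-ι p = ≃-sym (σᶠ-unique {ι p} (≃-trans (*-congˡ {σ p} (evalAt-mono q⁻¹ 0)) (*-identityʳ (σ p))))

σᶠ-0 : σᶠ 0# ≃ 0#
σᶠ-0 = σᶠ-ι []

σᶠ-1 : σᶠ 1# ≃ 1#
σᶠ-1 = ≃-trans (σᶠ-ι (mono 0)) (evalAt-mono q⁻¹ 0)

σᶠ-neg : ∀ x → σᶠ (- x) ≃ - σᶠ x
σᶠ-neg x = inverseˡ-unique (σᶠ (- x)) (σᶠ x) (begin
  σᶠ (- x) + σᶠ x      ≈⟨ σᶠ-+ (- x) x ⟨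
  σᶠ (- x + x)        ≈⟨ σᶠ-cong (-‿inverseˡ x) ⟩
  σᶠ 0#               ≈⟨ σᶠ-0 ⟩
  0#                 ∎)
  where open import Algebra.Properties.Group +-group using (inverseˡ-unique)

σᶠ-isRingHomomorphism : RingMorphisms.IsRingHomomorphism rawRing rawRing σᶠ
σᶠ-isRingHomomorphism = record
  { isSemiringHomomorphism = record
    { isNearSemiringHomomorphism = record
      { +-isMonoidHomomorphism = record
        { isMagmaHomomorphism = record
          { isRelHomomorphism = record { cong = σᶠ-cong }
          ; homo = σᶠ-+ }
        ; ε-homo = σᶠ-0 }
      ; *-homo = σᶠ-* }
    ; 1#-homo = σᶠ-1 }
  ; -‿homo = σᶠ-neg }

invQᶠ : Frac → Frac
invQᶠ x = frac (invQ (val x))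
  (*ₚ-nonzero (λ e → den≄0 x (reverse-≋-[] (den (val x)) e)) (mono-nonzero (length (num (val x)))))

invQ≃σᶠ : ∀ x → invQᶠ x ≃ σᶠ x
invQ≃σᶠ x = σᶠ-unique {x} (*-cancelʳ-nonzero *-zero-divisor ιD*q≄0 (begin
  (y * σ b) * (ι D * q)                        ≈⟨ interchange y (σ b) (ι D) q ⟩
  (y * ι D) * (σ b * q)                        ≈⟨ *-congʳ {σ b * q} (*-ι-den y) ⟩
  ι (reverse a *ₚ mono lb) * (σ b * q)         ≈⟨ *-congʳ {σ b * q} (ι-* (reverse a) (mono lb)) ⟩
  (ι (reverse a) * ι (mono lb)) * (σ b * q)    ≈⟨ swap-middle (ι (reverse a)) (ι (mono lb)) (σ b) q ⟩
  (ι (reverse a) * q) * (ι (mono lb) * σ b)    ≈⟨ *-cong (ι-reverse a) (*-congʳ {σ b} (ι-mono lb)) ⟩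
  (q ^ la * σ a) * (q ^ lb * σ b)              ≈⟨ regroup (q ^ la) (σ a) (q ^ lb) (σ b) ⟩
  σ a * ((q ^ lb * σ b) * q ^ la)              ≈⟨ *-congˡ {σ a} (*-cong (ι-reverse b) (ι-mono la)) ⟨
  σ a * ((ι (reverse b) * q) * ι (mono la))    ≈⟨ *-congˡ {σ a} (xy∙z≈xz∙y (ι (reverse b)) q (ι (mono la))) ⟩
  σ a * ((ι (reverse b) * ι (mono la)) * q)    ≈⟨ *-congˡ {σ a} (*-congʳ {q} (ι-* (reverse b) (mono la))) ⟨
  σ a * (ι D * q)                              ∎))
  where
  a = num (val x)
  b = den (val x)
  la = length a
  lb = length b
  D = reverse b *ₚ mono la
  y = invQᶠ x
  ιD*q≄0 : (ι D * q) ≄0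
  ιD*q≄0 = *-nonzero (ι-nonzero (*ₚ-nonzero (λ e → den≄0 x (reverse-≋-[] b e)) (mono-nonzero la))) q≄0
  swap-middle : ∀ A M s q → (A * M) * (s * q) ≃ (A * q) * (M * s)
  swap-middle = solve-∀ Frac-ACR
  regroup : ∀ qᵃ s qᵇ t → (qᵃ * s) * (qᵇ * t) ≃ s * ((qᵇ * t) * qᵃ)
  regroup = solve-∀ Frac-ACR

σᶠ-q : σᶠ q ≃ q⁻¹
σᶠ-q = ≃-trans (σᶠ-ι (mono 1)) (≃-trans (evalAt-mono q⁻¹ 1) (*-identityʳ q⁻¹))

σᶠ-q⁻¹ : σᶠ q⁻¹ ≃ q
σᶠ-q⁻¹ = inverse-unique {x = q⁻¹} (begin
  q⁻¹ * σᶠ q⁻¹      ≈⟨ *-congʳ {σᶠ q⁻¹} σᶠ-q ⟨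
  σᶠ q * σᶠ q⁻¹     ≈⟨ σᶠ-* q q⁻¹ ⟨
  σᶠ (q * q⁻¹)      ≈⟨ σᶠ-cong (*-inverseʳ q q≄0) ⟩
  σᶠ 1#             ≈⟨ σᶠ-1 ⟩
  1#                ∎)
  (≃-trans (*-comm q⁻¹ q) (*-inverseʳ q q≄0))

σᶠ-^ : ∀ x m → σᶠ (x ^ m) ≃ σᶠ x ^ m
σᶠ-^ = homo-^ σᶠ-isRingHomomorphism

pow*σᶠ[pow]≃1 : ∀ n → pow n * σᶠ (pow n) ≃ 1#
pow*σᶠ[pow]≃1 (+ m)    = begin
  q ^ m * σᶠ (q ^ m)  ≈⟨ *-congˡ {q ^ m} (≃-trans (σᶠ-^ q m) (^-congˡ m σᶠ-q)) ⟩
  q ^ m * q⁻¹ ^ m     ≈⟨ u^m*v^m≈1 m ⟩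
  1#                  ∎
pow*σᶠ[pow]≃1 -[1+ m ] = begin
  q⁻¹ ^ suc m * σᶠ (q⁻¹ ^ suc m)  ≈⟨ *-congˡ {q⁻¹ ^ suc m} (≃-trans (σᶠ-^ q⁻¹ (suc m)) (^-congˡ (suc m) σᶠ-q⁻¹)) ⟩
  q⁻¹ ^ suc m * q ^ suc m         ≈⟨ *-comm (q⁻¹ ^ suc m) (q ^ suc m) ⟩
  q ^ suc m * q⁻¹ ^ suc m         ≈⟨ u^m*v^m≈1 (suc m) ⟩
  1#                              ∎

σᶠ-[-1] : ∀ x → σᶠ (x - 1#) ≃ σᶠ x - 1#
σᶠ-[-1] x = ≃-trans (σᶠ-+ x (- 1#)) (+-congˡ {σᶠ x} (≃-trans (σᶠ-neg 1#) (-‿cong σᶠ-1)))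

-- [n]_q|_{q=1/q} = q [n]_q / qⁿ: apply σᶠ to [n]_q (q - 1) = qⁿ - 1 and
-- cancel q - 1.
σᶠ-qInt : ∀ n → σᶠ (qInt n) ≃ (q * qInt n) * σᶠ (pow n)
σᶠ-qInt n = *-cancelʳ-nonzero *-zero-divisor q-1≄0 (begin
  Y * (q - 1#)                           ≈⟨ insert-q*q⁻¹ Y q q⁻¹ ⟩
  - (Y * (q⁻¹ - 1#)) * q + Y * (q * q⁻¹ - 1#)
        ≈⟨ +-cong (*-congʳ {q} (-‿cong σᶠ-[n]*[q⁻¹-1])) (*-congˡ {Y} (+-congʳ { - 1#} (*-inverseʳ q q≄0))) ⟩
  - (J - 1#) * q + Y * (1# - 1#)         ≈⟨ collapse J q Y ⟩
  q * (1# - J)                           ≈⟨ *-congˡ {q} (+-congʳ { - J} (pow*σᶠ[pow]≃1 n)) ⟨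
  q * (P * J - J)                        ≈⟨ factor-q*J q J P ⟩
  (q * J) * (P - 1#)                     ≈⟨ *-congˡ {q * J} (qInt-*-q-1 n) ⟨
  (q * J) * (X * (q - 1#))               ≈⟨ regroup q X J ⟩
  ((q * X) * J) * (q - 1#)               ∎)
  where
  X = qInt n
  Y = σᶠ X
  P = pow n
  J = σᶠ P
  σᶠ-[n]*[q⁻¹-1] : Y * (q⁻¹ - 1#) ≃ J - 1#
  σᶠ-[n]*[q⁻¹-1] = begin
    Y * (q⁻¹ - 1#)        ≈⟨ *-congˡ {Y} (≃-trans (σᶠ-[-1] q) (+-congʳ { - 1#} σᶠ-q)) ⟨
    Y * σᶠ (q - 1#)       ≈⟨ σᶠ-* X (q - 1#) ⟨
    σᶠ (X * (q - 1#))     ≈⟨ σᶠ-cong (qInt-*-q-1 n) ⟩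
    σᶠ (P - 1#)           ≈⟨ σᶠ-[-1] P ⟩
    J - 1#                ∎
  insert-q*q⁻¹ : ∀ Y q q⁻¹ → Y * (q - 1#) ≃ - (Y * (q⁻¹ - 1#)) * q + Y * (q * q⁻¹ - 1#)
  insert-q*q⁻¹ = solve-∀ Frac-ACR
  collapse : ∀ J q Y → - (J - 1#) * q + Y * (1# - 1#) ≃ q * (1# - J)
  collapse = solve-∀ Frac-ACR
  factor-q*J : ∀ q J P → q * (P * J - J) ≃ (q * J) * (P - 1#)
  factor-q*J = solve-∀ Frac-ACR
  regroup : ∀ q X J → (q * J) * (X * (q - 1#)) ≃ ((q * X) * J) * (q - 1#)
  regroup = solve-∀ Frac-ACR

module _ (t : Frac) where

  evalAt-foldr-if : ∀ {a} {A : Set a} (b : A → Bool) (s : A → ℕ) (xs : List A) →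
    evalAt t (foldr (λ v acc → if b v then mono (s v) +ₚ acc else acc) [] xs)
      ≃ ∑[ v ∈ xs ] (if b v then t ^ s v else 0#)
  evalAt-foldr-if b s []       = ≃-refl
  evalAt-foldr-if b s (v ∷ xs) with b v
  ... | true  = ≃-trans (evalAt-+ t (mono (s v)) _) (+-cong (evalAt-mono t (s v)) (evalAt-foldr-if b s xs))
  ... | false = ≃-trans (evalAt-foldr-if b s xs) (≃-sym (+-identityˡ _))

evalAt-multichainPoly : ∀ {k} {_≼_ : Rel (Fin k) 0ℓ} (_≼?_ : Decidable _≼_) t f m →
  evalAt t (multichainPoly _≼?_ f m)
    ≃ ∑[ v ∈ allVecs k m ] (if weaklyIncr _≼?_ v then t ^ vsum _≼?_ f v else 0#)
evalAt-multichainPoly {k} _≼?_ t f m = evalAt-foldr-if t (weaklyIncr _≼?_) (vsum _≼?_ f) (allVecs k m)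

module _ {k : ℕ} {_≼_ : Rel (Fin k) 0ℓ} (_≼?_ : Decidable _≼_)
         (h : Fin k → ℕ) (H : ℕ) (h≤H : ∀ x → h x ≤ H) where

  private
    _≽?_ : Decidable (flip _≼_)
    _≽?_ = Flip.decidable _≼_ _≼?_

  multichainPoly-duality : ∀ m →
    ι (multichainPoly _≽?_ (λ x → H ∸ h x) m) ≃ q ^ (m ℕ.* H) * σ (multichainPoly _≼?_ h m)
  multichainPoly-duality m = begin
    ι (multichainPoly _≽?_ h′ m)
      ≈⟨ ι≃evalAt-q (multichainPoly _≽?_ h′ m) ⟩
    evalAt q (multichainPoly _≽?_ h′ m)
      ≈⟨ evalAt-multichainPoly _≽?_ q h′ m ⟩
    ∑[ v ∈ allVecs k m ] (if weaklyIncr _≽?_ v then q ^ vsum _≽?_ h′ v else 0#)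
      ≈⟨ sum-cong (allVecs k m) (λ v → ≃-reflexive (cong₂ (λ b s → if b then q ^ s else 0#)
           (weaklyIncr-flip-reverse _≼?_ v) (≡.sym (vsum-reverse _≼?_ h′ v)))) ⟩
    ∑[ v ∈ allVecs k m ] G (Vec.reverse v)
      ≈⟨ sum-allVecs-reverse k m G ⟩
    ∑[ v ∈ allVecs k m ] G v
      ≈⟨ sum-cong (allVecs k m) G≃ ⟩
    ∑[ v ∈ allVecs k m ] (q ^ (m ℕ.* H) * (if weaklyIncr _≼?_ v then q⁻¹ ^ vsum _≼?_ h v else 0#))
      ≈⟨ sum-*ˡ (allVecs k m) (q ^ (m ℕ.* H)) _ ⟩
    q ^ (m ℕ.* H) * ∑[ v ∈ allVecs k m ] (if weaklyIncr _≼?_ v then q⁻¹ ^ vsum _≼?_ h v else 0#)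
      ≈⟨ *-congˡ {q ^ (m ℕ.* H)} (evalAt-multichainPoly _≼?_ q⁻¹ h m) ⟨
    q ^ (m ℕ.* H) * σ (multichainPoly _≼?_ h m) ∎
    where
    h′ = λ x → H ∸ h x
    G : Vec (Fin k) m → Frac
    G v = if weaklyIncr _≼?_ v then q ^ vsum _≼?_ h′ v else 0#
    G≃ : ∀ v → G v ≃ q ^ (m ℕ.* H) * (if weaklyIncr _≼?_ v then q⁻¹ ^ vsum _≼?_ h v else 0#)
    G≃ v with weaklyIncr _≼?_ v
    ... | false = ≃-sym (zeroʳ (q ^ (m ℕ.* H)))
    ... | true  = begin
      q ^ a                          ≈⟨ *-identityʳ (q ^ a) ⟨
      q ^ a * 1#                     ≈⟨ *-congˡ {q ^ a} (u^m*v^m≈1 s) ⟨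
      q ^ a * (q ^ s * q⁻¹ ^ s)      ≈⟨ *-assoc (q ^ a) (q ^ s) (q⁻¹ ^ s) ⟨
      q ^ a * q ^ s * q⁻¹ ^ s        ≈⟨ *-congʳ {q⁻¹ ^ s} (^-homo-* q a s) ⟨
      q ^ (a ℕ.+ s) * q⁻¹ ^ s        ≡⟨ cong (λ e → q ^ e * q⁻¹ ^ s) (vsum-complement _≼?_ h H h≤H v) ⟩
      q ^ (m ℕ.* H) * q⁻¹ ^ s        ∎
      where
      a = vsum _≼?_ h′ v
      s = vsum _≼?_ h v

W : Frac → Frac
W y = 1# + (q - 1#) * y

W-qInt : ∀ n → W (qInt n) ≃ pow n
W-qInt n = begin
  1# + (q - 1#) * qInt n  ≈⟨ +-congˡ {1#} (*-comm (q - 1#) (qInt n)) ⟩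
  1# + qInt n * (q - 1#)  ≈⟨ +-congˡ {1#} (qInt-*-q-1 n) ⟩
  1# + (pow n - 1#)       ≈⟨ 1+[x-1]≃x (pow n) ⟩
  pow n                   ∎
  where
  1+[x-1]≃x : ∀ x → 1# + (x - 1#) ≃ x
  1+[x-1]≃x = solve-∀ Frac-ACR

pow-inverseˡ : ∀ a → pow (ℤ.- a) * pow a ≃ 1#
pow-inverseˡ a = ≃-trans (≃-sym (pow-+ (ℤ.- a) a)) (≃-reflexive (cong pow (ℤ.+-inverseˡ a)))

module Extension (Zs Zbs : List Frac) (H : ℕ) where

  private
    Lz D : ℕ
    Lz = length Zs
    D  = Lz ℕ.+ H
    e : ℤ → ℤ
    e n = n ℤ.* + Lz ℤ.+ + H

  Δ : ℤ → Frac
  Δ n = eval Zbs (qInt n) - pow ((n ℤ.- + 1) ℤ.* + H) * σᶠ (eval Zs (qInt n))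

  -- Δ with its denominators cleared: a polynomial function agreeing with
  -- a unit multiple of Δ n at [n]_q.
  P : Frac → Frac
  P y = q ^ H * (W y ^ Lz * eval Zbs y) - homogenise D (List.map σᶠ Zs) (0# + q * y) (W y)

  P-polynomial : IsPolynomial≤ ((Lz ℕ.+ length Zbs) ℕ.+ D) P
  P-polynomial = sub
    (raise (ℕ.m≤m+n (Lz ℕ.+ length Zbs) D) (scale (q ^ H) (affine^-* 1# (q - 1#) Lz (eval-polynomial Zbs))))
    (raise (ℕ.m≤n+m D (Lz ℕ.+ length Zbs)) (homogenise-polynomial D (List.map σᶠ Zs) 0# q 1# (q - 1#)))

  homogenise-qInt : ∀ n → homogenise D (List.map σᶠ Zs) (0# + q * qInt n) (W (qInt n))
                          ≃ pow n ^ D * σᶠ (eval Zs (qInt n))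
  homogenise-qInt n = begin
    homogenise D (List.map σᶠ Zs) (0# + q * x) (W x)
      ≈⟨ homogenise-eval D (List.map σᶠ Zs) {u = 0# + q * x} {v = W x} {w = J} W*J≃1 length≤D ⟩
    W x ^ D * eval (List.map σᶠ Zs) ((0# + q * x) * J)
      ≈⟨ *-cong (^-congˡ D (W-qInt n)) (eval-congʳ (List.map σᶠ Zs) u*J≃σᶠx) ⟩
    pow n ^ D * eval (List.map σᶠ Zs) (σᶠ x)
      ≈⟨ *-congˡ {pow n ^ D} (eval-homo σᶠ-isRingHomomorphism Zs x) ⟨
    pow n ^ D * σᶠ (eval Zs x)   ∎
    where
    x = qInt n
    J = σᶠ (pow n)
    W*J≃1 : W x * J ≃ 1#
    W*J≃1 = ≃-trans (*-congʳ {J} (W-qInt n)) (pow*σᶠ[pow]≃1 n)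
    length≤D : length (List.map σᶠ Zs) ≤ D
    length≤D = ℕ.≤-trans (ℕ.≤-reflexive (List.length-map σᶠ Zs)) (ℕ.m≤m+n Lz H)
    u*J≃σᶠx : (0# + q * x) * J ≃ σᶠ x
    u*J≃σᶠx = ≃-trans (*-congʳ {J} (+-identityˡ (q * x))) (≃-sym (σᶠ-qInt n))

  P-qInt : ∀ n → P (qInt n) ≃ pow (e n) * Δ n
  P-qInt n = begin
    q ^ H * (W x ^ Lz * Zb) - homogenise D (List.map σᶠ Zs) (0# + q * x) (W x)
      ≈⟨ +-cong (*-congˡ {q ^ H} (*-congʳ {Zb} W^Lz)) (-‿cong (homogenise-qInt n)) ⟩
    q ^ H * (pow (n ℤ.* + Lz) * Zb) - pow n ^ D * σᶠZ
      ≈⟨ +-congˡ {q ^ H * (pow (n ℤ.* + Lz) * Zb)} (-‿cong (*-congʳ {σᶠZ} pow^D)) ⟩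
    q ^ H * (pow (n ℤ.* + Lz) * Zb) - (pow (n ℤ.* + Lz) * (q ^ H * V)) * σᶠZ
      ≈⟨ factor-Δ (q ^ H) (pow (n ℤ.* + Lz)) Zb V σᶠZ ⟩
    (pow (n ℤ.* + Lz) * q ^ H) * Δ n
      ≈⟨ *-congʳ {Δ n} (pow-+ (n ℤ.* + Lz) (+ H)) ⟨
    pow (n ℤ.* + Lz ℤ.+ + H) * Δ n   ∎
    where
    x  = qInt n
    Zb = eval Zbs x
    σᶠZ = σᶠ (eval Zs x)
    V-exp = (n ℤ.- + 1) ℤ.* + H
    V  = pow V-exp
    W^Lz : W x ^ Lz ≃ pow (n ℤ.* + Lz)
    W^Lz = ≃-trans (^-congˡ Lz (W-qInt n)) (≃-sym (pow-*ℕ n Lz))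
    n*H≡H+[n-1]*H : n ℤ.* + H ≡ + H ℤ.+ V-exp
    n*H≡H+[n-1]*H = n*h≡h+[n-1]*h n (+ H)
      where
      n*h≡h+[n-1]*h : ∀ n h → n ℤ.* h ≡ h ℤ.+ (n ℤ.- + 1) ℤ.* h
      n*h≡h+[n-1]*h = ℤ-Solver.solve-∀
    pow^D : pow n ^ D ≃ pow (n ℤ.* + Lz) * (q ^ H * V)
    pow^D = begin
      pow n ^ (Lz ℕ.+ H)                         ≈⟨ ^-homo-* (pow n) Lz H ⟩
      pow n ^ Lz * pow n ^ H                     ≈⟨ *-cong (pow-*ℕ n Lz) (pow-*ℕ n H) ⟨
      pow (n ℤ.* + Lz) * pow (n ℤ.* + H)         ≈⟨ *-congˡ {pow (n ℤ.* + Lz)} (≃-reflexive (cong pow n*H≡H+[n-1]*H)) ⟩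
      pow (n ℤ.* + Lz) * pow (+ H ℤ.+ V-exp)     ≈⟨ *-congˡ {pow (n ℤ.* + Lz)} (pow-+ (+ H) V-exp) ⟩
      pow (n ℤ.* + Lz) * (q ^ H * V)             ∎
    factor-Δ : ∀ qᴴ c Zb V σᶠZ → qᴴ * (c * Zb) - (c * (qᴴ * V)) * σᶠZ ≃ (c * qᴴ) * (Zb - V * σᶠZ)
    factor-Δ = solve-∀ Frac-ACR

  Δ≃0-from-multichains : ∀ {k} {_≼_ : Rel (Fin k) 0ℓ} (_≼?_ : Decidable _≼_) h → (∀ x → h x ≤ H) →
    (∀ n → 2 ≤ n → eval Zs (qInt (+ n)) ≃ ι (multichainPoly _≼?_ h (n ∸ 1))) →
    (∀ n → 2 ≤ n → eval Zbs (qInt (+ n))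
                   ≃ ι (multichainPoly (Flip.decidable _≼_ _≼?_) (λ x → H ∸ h x) (n ∸ 1))) →
    ∀ n → 2 ≤ n → Δ (+ n) ≃ 0#
  Δ≃0-from-multichains _≼?_ h h≤H Z-values Zbar-values (suc m) 2≤n = x≈y⇒x∙y⁻¹≈ε (begin
    eval Zbs (qInt (+ suc m))                          ≈⟨ Zbar-values (suc m) 2≤n ⟩
    ι (multichainPoly _ (λ x → H ∸ h x) m)             ≈⟨ multichainPoly-duality _≼?_ h H h≤H m ⟩
    q ^ (m ℕ.* H) * σ (multichainPoly _≼?_ h m)        ≈⟨ *-cong q^[m*H] σᶠZ ⟨
    pow (+ m ℤ.* + H) * σᶠ (eval Zs (qInt (+ suc m)))  ∎)
    where
    open import Algebra.Properties.Group +-group using (x≈y⇒x∙y⁻¹≈ε)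
    q^[m*H] : pow (+ m ℤ.* + H) ≃ q ^ (m ℕ.* H)
    q^[m*H] = ≃-reflexive (cong pow (≡.sym (ℤ.pos-* m H)))
    σᶠZ : σᶠ (eval Zs (qInt (+ suc m))) ≃ σ (multichainPoly _≼?_ h m)
    σᶠZ = ≃-trans (σᶠ-cong (Z-values (suc m) 2≤n)) (σᶠ-ι (multichainPoly _≼?_ h m))

  Δ≃0-extends : (∀ n → 2 ≤ n → Δ (+ n) ≃ 0#) → ∀ n → Δ n ≃ 0#
  Δ≃0-extends Δ[n]≃0 n = begin
    Δ n                                   ≈⟨ *-identityˡ (Δ n) ⟨
    1# * Δ n                              ≈⟨ *-congʳ {Δ n} (pow-inverseˡ (e n)) ⟨
    (pow (ℤ.- e n) * pow (e n)) * Δ n     ≈⟨ *-assoc (pow (ℤ.- e n)) (pow (e n)) (Δ n) ⟩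
    pow (ℤ.- e n) * (pow (e n) * Δ n)     ≈⟨ *-congˡ {pow (ℤ.- e n)} (P-qInt n) ⟨
    pow (ℤ.- e n) * P (qInt n)            ≈⟨ *-congˡ {pow (ℤ.- e n)} (P≃0 (qInt n)) ⟩
    pow (ℤ.- e n) * 0#                    ≈⟨ zeroʳ (pow (ℤ.- e n)) ⟩
    0#                                    ∎
    where
    P[n]≃0 : ∀ m → 2 ≤ m → P (qInt (+ m)) ≃ 0#
    P[n]≃0 m 2≤m = ≃-trans (P-qInt (+ m)) (≃-trans (*-congˡ {pow (e (+ m))} (Δ[n]≃0 m 2≤m)) (zeroʳ (pow (e (+ m)))))
    P≃0 : ∀ y → P y ≃ 0#
    P≃0 = polynomial-≈0 *-zero-divisor _ P-polynomial (λ m → qInt (+ m)) qInt-injective 2 P[n]≃0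

open Defs using (_≈_)

toFrac : (cs : PolyQ) → All WF cs → List Frac
toFrac []       []         = []
toFrac (c ∷ cs) (wf ∷ wfs) = fromWF c wf ∷ toFrac cs wfs

val-eval : ∀ cs wfs x → val (eval (toFrac cs wfs) x) ≡ evalQ cs (val x)
val-eval []       []         x = refl
val-eval (c ∷ cs) (wf ∷ wfs) x = cong (λ e → c +r (val x *r e)) (val-eval cs wfs x)

≃⇒≈ : ∀ {x y a b} → val x ≡ a → val y ≡ b → x ≃ y → a ≈ b
≃⇒≈ refl refl (mk≃ e) = coeff-≡ e

≈⇒≃ : ∀ {x y a b} → val x ≡ a → val y ≡ b → a ≈ b → x ≃ y
≈⇒≃ refl refl e = mk≃ (mk≋ e)

mainTheorem13 : (k : ℕ) (_≼_ : Rel (Fin k) 0ℓ) (isPO : IsDecPartialOrder _≡_ _≼_)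
    (h : Fin k → ℕ) → IsHeight _≼_ h →
    (H : ℕ) → (∀ x → h x ≤ H) →
    (Z Zbar : PolyQ) →
    IsQZeta (IsDecPartialOrder._≤?_ isPO) h Z →
    IsQZeta {_≼_ = flip _≼_} (λ x y → IsDecPartialOrder._≤?_ isPO y x) (λ x → H ∸ h x) Zbar →
    (n : ℤ) →
    evalQ Zbar (qint n) ≈ (qpow ((n ℤ.- + 1) ℤ.* + H) *r invQ (evalQ Z (qint n)))
mainTheorem13 k _≼_ isPO h _ H h≤H Z Zbar (Z-wf , Z-values) (Zbar-wf , Zbar-values) n =
  ≃⇒≈ (val-eval Zbar Zbar-wf (qInt n)) (cong (λ z → qpow V *r invQ z) (val-eval Z Z-wf (qInt n))) (begin
    eval Zbs (qInt n)                 ≈⟨ x∙y⁻¹≈ε⇒x≈y _ _ (Δ≃0-extends Δ[n]≃0 n) ⟩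
    pow V * σᶠ (eval Zs (qInt n))      ≈⟨ *-cong (qPow≃pow V) (invQ≃σᶠ (eval Zs (qInt n))) ⟨
    qPow V * invQᶠ (eval Zs (qInt n))  ∎)
  where
  open import Algebra.Properties.Group +-group using (x∙y⁻¹≈ε⇒x≈y)
  Zs Zbs : List Frac
  Zs = toFrac Z Z-wf
  Zbs = toFrac Zbar Zbar-wf
  V : ℤ
  V = (n ℤ.- + 1) ℤ.* + H
  open Extension Zs Zbs H
  Δ[n]≃0 : ∀ m → 2 ≤ m → Δ (+ m) ≃ 0#
  Δ[n]≃0 = Δ≃0-from-multichains (IsDecPartialOrder._≤?_ isPO) h h≤H
    (λ m 2≤m → ≈⇒≃ (val-eval Z Z-wf (qInt (+ m))) refl (Z-values m 2≤m))
    (λ m 2≤m → ≈⇒≃ (val-eval Zbar Zbar-wf (qInt (+ m))) refl (Zbar-values m 2≤m))
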